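{- Every abstract map without vertices of degree $1$, $3$ or $5$ has a compatible decomposition.
   Context: An abstract map $(V,E,\varphi)$ is a finite multigraph (with finitely many vertices and edges, at least one vertex) in which loops and half-edges are allowed, together with a cyclic ordering of the edge-ends at each vertex. Each edge has two ends; one end is incident with a vertex, the other may or may not be. An edge with exactly one end incident with a vertex is a half-edge; an edge with both ends incident with the same vertex is a loop. The degree $d_v$ of a vertex $v$ is the number of edge-ends incident with $v$ (loops counted twice). The cyclic orderings are given by a surjective map $\varphi: V\times\mathbb{N}\to E$ such that $\varphi(v,n)$ is an edge incident with $v$, $\varphi(v,n)=\varphi(v,n+d_v)$ for all $(v,n)$, and $\varphi(v,1),\ldots,\varphi(v,d_v)$ lists the ends at $v$ in cyclic order; an edge has two preimages in $\{v\}\times\{1,\ldots,d_v\}$ iff it is a loop at $v$. A trail is a sequence $e_1,\ldots,e_k$ of mutually distinct edges such that for $i\in\{1,\ldots,k-1\}$, $e_i$ and $e_{i+1}$ have a common end-vertex $v_i$ (the trail passes from an end of $e_i$ at $v_i$ to an end of $e_{i+1}$ at $v_i$; then $e_i,e_{i+1}$ are called consecutive in the trail), and for $i\in\{2,\ldots,k-1\}$, $v_{i-1}\ne v_i$ unless $e_i$ is a loop (i.e., the trail traverses each edge from one of its ends to the other). A trail with these properties is open; a closed trail is one whose edge ordering is cyclic, obtained when a trail starting and ending at the same vertex $v$ is additionally joined at $v$ from its last edge to its first edge (so its last and first edges also become consecutive). A compatible decomposition of an abstract map $G$ is a collection of open trails $W_1,\ldots,W_K$ such that every edge of $G$ lies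 in exactly one of them and for every vertex $v$ of odd degree there is an index $i_v$ such that each of the following pairs (positions of ends at $v$) are consecutive (in either order) in some trail, passing through $v$ via these ends: $\varphi(v,i_v)$ and $\varphi(v,i_v+5)$; $\varphi(v,i_v+1)$ and $\varphi(v,i_v+3)$; $\varphi(v,i_v+2)$ and $\varphi(v,i_v+4)$. Vertices of even degree impose no condition. -}

module Defs where

open import Data.Nat using (ℕ; zero; suc; _+_; _*_; _≤_)
open import Data.Fin using (Fin; toℕ; inject₁) renaming (suc to fsuc)
open import Data.Product using (Σ; ∃; ∃-syntax; _×_; _,_)
open import Data.Sum using (_⊎_)
open import Relation.Binary.PropositionalEquality using (_≡_; _≢_)

-- Vertices are Fin n (n ≥ 1), edges are Fin m.  deg v is the degree d_v
-- and φ v x (x : Fin (deg v)) is the edge occupying position x of the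
-- cyclic order at v (position x stands for φ(v, x + q·d_v), any q).
-- A "position" (v , x) is an edge-end incident with a vertex.  Every edge
-- has one or two such ends: exactly one = half-edge, two at the same
-- vertex = loop, two at distinct vertices = ordinary edge.

record AbstractMap : Set where
  field
    n       : ℕ
    m       : ℕ
    nonempty : 1 ≤ n
    deg     : Fin n → ℕ
    φ       : (v : Fin n) → Fin (deg v) → Fin m

  Position : Set
  Position = Σ (Fin n) (λ v → Fin (deg v))

  edgeAt : Position → Fin m
  edgeAt (v , x) = φ v x

  field
    surjective : (e : Fin m) → ∃[ p ] edgeAt p ≡ e
    atMostTwo  : (p q r : Position) → edgeAt p ≡ edgeAt q → edgeAt q ≡ edgeAt r →
                 p ≡ q ⊎ q ≡ r ⊎ p ≡ r

-- Open trails  e_0, …, e_k  (k+1 edges).  Between e_i and e_{i+1} the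
-- trail passes through vertex tv i, leaving e_i via the end (position)
-- out i and entering e_{i+1} via the end inn i.  Each inner edge is
-- traversed from one of its ends to the other: the end by which it is
-- entered differs from the end by which it is left.

module _ (M : AbstractMap) where
  open AbstractMap M

  record Trail : Set where
    field
      k        : ℕ
      edge     : Fin (suc k) → Fin m
      distinct : (i j : Fin (suc k)) → edge i ≡ edge j → i ≡ j
      tv       : Fin k → Fin n
      out      : (i : Fin k) → Fin (deg (tv i))
      inn      : (i : Fin k) → Fin (deg (tv i))
      out-ok   : (i : Fin k) → φ (tv i) (out i) ≡ edge (inject₁ i)
      inn-ok   : (i : Fin k) → φ (tv i) (inn i) ≡ edge (fsuc i)
      traverse : (i j : Fin k) → fsuc i ≡ inject₁ j →
                 _≢_ {A = Position} (tv i , inn i) (tv j , out j)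

  -- "position a (a natural number, read modulo d_v) at v is the end x"
  Rep : (v : Fin n) → ℕ → Fin (deg v) → Set
  Rep v a x = ∃[ q ] a ≡ toℕ x + q * deg v

  -- The ends φ(v,a) and φ(v,b) are consecutive in trail W, which passes
  -- through v via exactly these two ends (in either order).
  ConsecutiveIn : Trail → Fin n → ℕ → ℕ → Set
  ConsecutiveIn W v a b =
    ∃[ t ] (tv t ≡ v ×
      ((Rep (tv t) a (out t) × Rep (tv t) b (inn t)) ⊎
       (Rep (tv t) b (out t) × Rep (tv t) a (inn t))))
    where open Trail W

  Odd : ℕ → Set
  Odd d = ∃[ h ] d ≡ suc (h + h)

  record CompatibleDecomposition : Set where
    field
      K      : ℕ
      W      : Fin K → Trail
      cover  : (e : Fin m) → ∃[ j ] ∃[ t ] Trail.edge (W j) t ≡ e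
      disjoint : (j j′ : Fin K) (t : Fin (suc (Trail.k (W j))))
                 (t′ : Fin (suc (Trail.k (W j′)))) →
                 Trail.edge (W j) t ≡ Trail.edge (W j′) t′ → j ≡ j′
      compatible : (v : Fin n) → Odd (deg v) → ∃[ i ]
        ((∃[ j ] ConsecutiveIn (W j) v i (i + 5)) ×
         (∃[ j ] ConsecutiveIn (W j) v (i + 1) (i + 3)) ×
         (∃[ j ] ConsecutiveIn (W j) v (i + 2) (i + 4)))

module Submission where

-- Start from the decomposition into one-edge trails and treat
-- the vertices one after the other.  At a vertex v of odd degree d ≥ 7 we
-- choose an index i and join, at v, the three pairs of ends (i , i+5),
-- (i+1 , i+3), (i+2 , i+4) required by the definition.  Joining two trails
-- at two ends at v gives a trail again, unless these are the two ends of one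
-- and the same trail (the result would be closed).  Ends at v are joined only
-- while v is treated, so they are all free when we arrive at v.  The
-- relation "the two ends bound a common trail" is a matching on the d ends,
-- and d is odd, so some end u is unmatched (a fixed-point-free involution has
-- an even number of points); joining u first is always harmless.  A finite
-- case analysis (the window lemma) shows that for one of five windows i
-- containing u the two remaining joins do not close a trail either.

open import Defs
open import Data.Nat using (ℕ; zero; suc; _+_; _*_; _∸_; _≤_; _<_; s≤s; z≤n; NonZero; >-nonZero; _<ᵇ_; _≤ᵇ_)
open import Data.Nat.Properties
open import Data.Nat.DivMod using (_mod_; _%_; _/_; m≡m%n+[m/n]*n; [m+n]%n≡m%n; m<n⇒m%n≡m; m%n<n)
open import Data.Bool using (Bool; true; T; _∧_; _∨_)
open import Data.Bool.Properties using (T-∧; T-∨)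
open import Data.Fin using (Fin; toℕ; inject₁) renaming (zero to fzero; suc to fsuc)
import Data.Fin.Properties as Finₚ
open import Data.Product using (Σ; ∃; ∃-syntax; _×_; _,_; proj₁; proj₂)
import Data.Product as Product
import Data.Product.Properties as Productₚ
open import Data.Sum using (_⊎_; inj₁; inj₂)
import Data.Sum as Sum
open import Data.Empty using (⊥; ⊥-elim)
open import Data.Unit using (⊤; tt)
open import Data.Maybe using (Maybe; just; nothing)
import Data.Maybe.Properties as Maybeₚ
open import Data.List using (List; []; _∷_; length; _++_; [_]; allFin; lookup; map; concatMap)
import Data.List.Properties as Listₚ
open import Data.List.Membership.Propositional using (_∈_; _∉_)
open import Data.List.Membership.Propositional.Properties
  using (∈-++⁺ˡ; ∈-++⁺ʳ; ∈-++⁻; ∈-allFin; ∈-lookup; ∈-map⁺; ∈-map⁻; ∈-concatMap⁺)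
open import Data.List.Relation.Unary.Any using (Any; here; there)
import Data.List.Relation.Unary.Any as Any
import Data.List.Relation.Unary.AllPairs as AllPairs
open import Data.List.Relation.Unary.Unique.Propositional using (Unique)
open import Data.List.Relation.Unary.Unique.Propositional.Properties using (allFin⁺; Unique[x∷xs]⇒x∉xs)
open import Data.List.Relation.Binary.Permutation.Propositional using (_↭_; ↭-refl; ↭-sym; ↭-trans; prep; swap)
import Data.List.Relation.Binary.Permutation.Propositional as Perm
open import Data.List.Relation.Binary.Permutation.Propositional.Properties
  using (++⁺ˡ; ++⁺ʳ; ++-comm; shifts; ∈-resp-↭; Any-resp-↭)
open import Function using (_∘_)
open import Function.Bundles using (Equivalence)
open import Relation.Nullary using (¬_; Dec; yes; no; ¬?; _×-dec_; _⊎-dec_)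
open import Relation.Nullary.Decidable using (decidable-stable)
open import Relation.Binary.Definitions using (DecidableEquality)
open import Relation.Binary.PropositionalEquality hiding ([_])

-- Duplicate-freeness as nested non-membership, convenient for pattern
-- matching; it is how we express that the edges of all trails are distinct.
Distinct : {A : Set} → List A → Set
Distinct []       = ⊤
Distinct (x ∷ xs) = x ∉ xs × Distinct xs

Unique⇒Distinct : {A : Set} {xs : List A} → Unique xs → Distinct xs
Unique⇒Distinct {xs = []}     _                    = tt
Unique⇒Distinct {xs = x ∷ xs} u@(_ AllPairs.∷ u′) = Unique[x∷xs]⇒x∉xs u , Unique⇒Distinct u′

distinct-++ˡ : {A : Set} (xs ys : List A) → Distinct (xs ++ ys) → Distinct xs
distinct-++ˡ []       ys u         = tt
distinct-++ˡ (x ∷ xs) ys (x∉ , u) = (x∉ ∘ ∈-++⁺ˡ) , distinct-++ˡ xs ys u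

distinct-++ʳ : {A : Set} (xs ys : List A) → Distinct (xs ++ ys) → Distinct ys
distinct-++ʳ []       ys u        = u
distinct-++ʳ (x ∷ xs) ys (_ , u) = distinct-++ʳ xs ys u

distinct-++-disjoint : {A : Set} (xs ys : List A) → Distinct (xs ++ ys) → ∀ {z} → z ∈ xs → z ∈ ys → ⊥
distinct-++-disjoint (x ∷ xs) ys (x∉ , u) (here refl) z∈ys = x∉ (∈-++⁺ʳ xs z∈ys)
distinct-++-disjoint (x ∷ xs) ys (x∉ , u) (there z∈) z∈ys = distinct-++-disjoint xs ys u z∈ z∈ys

distinct-resp-↭ : {A : Set} {xs ys : List A} → xs ↭ ys → Distinct xs → Distinct ys
distinct-resp-↭ Perm.refl           u              = u
distinct-resp-↭ (Perm.prep x p)     (x∉ , u)       = (x∉ ∘ ∈-resp-↭ (↭-sym p)) , distinct-resp-↭ p u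
distinct-resp-↭ (Perm.swap x y p)   (x∉ , y∉ , u) =
  (λ { (here refl) → x∉ (here refl) ; (there y∈) → y∉ (∈-resp-↭ (↭-sym p) y∈) }) ,
  (x∉ ∘ there ∘ ∈-resp-↭ (↭-sym p)) , distinct-resp-↭ p u
distinct-resp-↭ (Perm.trans p q)    u              = distinct-resp-↭ q (distinct-resp-↭ p u)

-- Parity of fixed-point-free involutions

Even : ℕ → Set
Even k = ∃[ h ] k ≡ h + h

parity : ∀ d → (∃[ h ] d ≡ suc (h + h)) ⊎ Even d
parity zero    = inj₂ (0 , refl)
parity (suc d) with parity d
... | inj₁ (h , eq) = inj₂ (suc h , cong suc (trans eq (sym (+-suc h h))))
... | inj₂ (h , eq) = inj₁ (h , cong suc eq)

-- The library's even≢odd, for the h + h form of parity used in Defs.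
even≢odd′ : ∀ a b → a + a ≢ suc (b + b)
even≢odd′ a b eq = even≢odd a b (trans (cong (a +_) (+-identityʳ a))
                                  (trans eq (cong (λ c → suc (b + c)) (sym (+-identityʳ b)))))

module Removal {A : Set} (_≟_ : DecidableEquality A) where

  remove : A → List A → List A
  remove r []       = []
  remove r (y ∷ ys) with r ≟ y
  ... | yes _ = ys
  ... | no  _ = y ∷ remove r ys

  length-remove : ∀ r ys → r ∈ ys → suc (length (remove r ys)) ≡ length ys
  length-remove r (y ∷ ys) r∈ with r ≟ y
  ... | yes _ = refl
  length-remove r (y ∷ ys) (here r≡y) | no r≢y = ⊥-elim (r≢y r≡y)
  length-remove r (y ∷ ys) (there r∈) | no r≢y = cong suc (length-remove r ys r∈)

  ∈-remove⁻ : ∀ {z} r ys → z ∈ remove r ys → z ∈ ys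
  ∈-remove⁻ r (y ∷ ys) z∈ with r ≟ y
  ... | yes _ = there z∈
  ∈-remove⁻ r (y ∷ ys) (here eq)  | no _ = here eq
  ∈-remove⁻ r (y ∷ ys) (there z∈) | no _ = there (∈-remove⁻ r ys z∈)

  ∈-remove⁺ : ∀ {z} r ys → z ∈ ys → z ≢ r → z ∈ remove r ys
  ∈-remove⁺ r (y ∷ ys) z∈ z≢r with r ≟ y
  ∈-remove⁺ r (y ∷ ys) (here z≡y) z≢r | yes r≡y = ⊥-elim (z≢r (trans z≡y (sym r≡y)))
  ∈-remove⁺ r (y ∷ ys) (there z∈) z≢r | yes _   = z∈
  ∈-remove⁺ r (y ∷ ys) (here eq)  z≢r | no _    = here eq
  ∈-remove⁺ r (y ∷ ys) (there z∈) z≢r | no _    = there (∈-remove⁺ r ys z∈ z≢r)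

  distinct-remove : ∀ r ys → Distinct ys → Distinct (remove r ys)
  distinct-remove r []       u         = u
  distinct-remove r (y ∷ ys) (y∉ , u) with r ≟ y
  ... | yes _ = u
  ... | no  _ = (y∉ ∘ ∈-remove⁻ r ys) , distinct-remove r ys u

  ∈-remove-≢ : ∀ {z} r ys → Distinct ys → z ∈ remove r ys → z ≢ r
  ∈-remove-≢ r (y ∷ ys) (y∉ , u) z∈ with r ≟ y
  ∈-remove-≢ r (y ∷ ys) (y∉ , u) z∈          | yes refl = λ { refl → y∉ z∈ }
  ∈-remove-≢ r (y ∷ ys) (y∉ , u) (here refl) | no r≢y   = r≢y ∘ sym
  ∈-remove-≢ r (y ∷ ys) (y∉ , u) (there z∈)  | no r≢y   = ∈-remove-≢ r ys u z∈

-- A duplicate-free list closed under a fixed-point-free involution f has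
-- even length: f pairs off its elements.  Removing x and f x preserves the
-- hypotheses, and we recurse on the length.
module Involution {A : Set} (_≟_ : DecidableEquality A) (f : A → A)
                  (f-involutive : ∀ x → f (f x) ≡ x) (f-no-fixpoint : ∀ x → f x ≢ x) where
  open Removal _≟_

  even-length : ∀ k xs → length xs ≡ k → Distinct xs → (∀ {x} → x ∈ xs → f x ∈ xs) → Even k
  even-length _ [] refl _ _ = 0 , refl
  even-length (suc k) (x ∷ xs) len (x∉ , u) closed = pair-off k (suc-injective len)
    where
    fx∈xs : f x ∈ xs
    fx∈xs with closed (here refl)
    ... | here fx≡x = ⊥-elim (f-no-fixpoint x fx≡x)
    ... | there p   = p
    rest = remove (f x) xs
    rest-closed : ∀ {z} → z ∈ rest → f z ∈ rest
    rest-closed {z} z∈ = ∈-remove⁺ (f x) xs fz∈xs fz≢fx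
      where
      z∈xs = ∈-remove⁻ (f x) xs z∈
      fz≢fx : f z ≢ f x
      fz≢fx e = x∉ (subst (_∈ xs) (trans (sym (f-involutive z)) (trans (cong f e) (f-involutive x))) z∈xs)
      fz∈xs : f z ∈ xs
      fz∈xs with closed (there z∈xs)
      ... | here fz≡x = ⊥-elim (∈-remove-≢ (f x) xs u z∈ (trans (sym (f-involutive z)) (cong f fz≡x)))
      ... | there p   = p
    pair-off : ∀ k → length xs ≡ k → Even (suc k)
    pair-off zero    len′ = ⊥-elim (occupied fx∈xs len′)
      where
      occupied : ∀ {y ys} → y ∈ ys → length ys ≢ 0
      occupied (here _)  ()
      occupied (there _) ()
    pair-off (suc k) len′ with even-length k rest (suc-injective (trans (length-remove (f x) xs fx∈xs) len′))
                                           (distinct-remove (f x) xs u) rest-closed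
    ... | h , k≡h+h = suc h , cong suc (trans (cong suc k≡h+h) (sym (+-suc h h)))

-- A matching on a set of odd size leaves a point unmatched: otherwise
-- "the partner of x" would be a fixed-point-free involution of Fin d.
unmatched-point : ∀ {d} (R : Fin d → Fin d → Set) → (∀ x y → Dec (R x y)) →
                  (∀ {x y} → R x y → R y x) → (∀ {x y z} → R x y → R x z → y ≡ z) → (∀ {x} → ¬ R x x) →
                  (∃[ h ] d ≡ suc (h + h)) → ∃[ u ] (∀ y → ¬ R u y)
unmatched-point {d} R R? R-sym R-fun R-irr (h , d-odd)
  with Finₚ.any? (λ u → Finₚ.all? (λ y → ¬? (R? u y)))
... | yes found      = found
... | no none-free = ⊥-elim (even≢odd′ h′ h (trans (sym d-even) d-odd))
  where
  partnered : ∀ x → ∃[ y ] R x y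
  partnered x with Finₚ.¬∀⟶∃¬ d (λ y → ¬ R x y) (λ y → ¬? (R? x y)) (λ all → none-free (x , all))
  ... | y , ¬¬Rxy = y , decidable-stable (R? x y) ¬¬Rxy
  partner : Fin d → Fin d
  partner = proj₁ ∘ partnered
  open Involution Finₚ._≟_ partner
    (λ x → sym (R-fun (R-sym (proj₂ (partnered x))) (proj₂ (partnered (partner x)))))
    (λ x e → R-irr (subst (R x) e (proj₂ (partnered x))))
  halves = even-length d (allFin d) (Listₚ.length-tabulate (λ x → x)) (Unique⇒Distinct (allFin⁺ d)) (λ _ → ∈-allFin _)
  h′ = proj₁ halves
  d-even : d ≡ h′ + h′
  d-even = proj₂ halves

mod-rep : ∀ a d .{{_ : NonZero d}} → a ≡ toℕ (a mod d) + (a / d) * d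
mod-rep a d = trans (m≡m%n+[m/n]*n a d) (cong (_+ (a / d) * d) (sym (Finₚ.toℕ-fromℕ< (m%n<n a d))))

mod-periodic : ∀ a d .{{_ : NonZero d}} → (a + d) mod d ≡ a mod d
mod-periodic a d = Finₚ.toℕ-injective (begin
  toℕ ((a + d) mod d) ≡⟨ Finₚ.toℕ-fromℕ< (m%n<n (a + d) d) ⟩
  (a + d) % d         ≡⟨ [m+n]%n≡m%n a d ⟩
  a % d               ≡⟨ Finₚ.toℕ-fromℕ< (m%n<n a d) ⟨
  toℕ (a mod d)       ∎)
  where open ≡-Reasoning

mod-toℕ : ∀ d .{{_ : NonZero d}} (u : Fin d) → toℕ u mod d ≡ u
mod-toℕ d u = Finₚ.toℕ-injective (trans (Finₚ.toℕ-fromℕ< (m%n<n (toℕ u) d)) (m<n⇒m%n≡m (Finₚ.toℕ<n u)))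

mod-injective-window : ∀ a b d .{{_ : NonZero d}} → a < b → b < a + d → a mod d ≢ b mod d
mod-injective-window a b d a<b b<a+d eq = <⇒≱ b<a+d a+d≤b
  where
  r = a % d
  same-rem : a % d ≡ b % d
  same-rem = trans (sym (Finₚ.toℕ-fromℕ< (m%n<n a d))) (trans (cong toℕ eq) (Finₚ.toℕ-fromℕ< (m%n<n b d)))
  ea : a ≡ r + (a / d) * d
  ea = m≡m%n+[m/n]*n a d
  eb : b ≡ r + (b / d) * d
  eb = trans (m≡m%n+[m/n]*n b d) (cong (_+ (b / d) * d) (sym same-rem))
  quot< : a / d < b / d
  quot< = *-cancelʳ-< d (a / d) (b / d) (+-cancelˡ-< r _ _ (subst₂ _<_ ea eb a<b))
  a+d≤b : a + d ≤ b
  a+d≤b = begin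
    a + d                 ≡⟨ cong (_+ d) ea ⟩
    r + (a / d) * d + d   ≡⟨ +-assoc r _ d ⟩
    r + ((a / d) * d + d) ≡⟨ cong (r +_) (+-comm ((a / d) * d) d) ⟩
    r + suc (a / d) * d   ≤⟨ +-monoʳ-≤ r (*-monoˡ-≤ d quot<) ⟩
    r + (b / d) * d       ≡⟨ eb ⟨
    b                     ∎
    where open ≤-Reasoning

-- The window lemma

-- "1 ≤ i < j ≤ k", as a boolean so that instances are checked by evaluation.
inRange : ℕ → ℕ → ℕ → Bool
inRange k i j = (1 ≤ᵇ i) ∧ (i <ᵇ j) ∧ (j ≤ᵇ k)

-- R x y reads "the ends x and y bound one and the same trail".  Joining the
-- ends a, b and then c, e never closes a trail if the configuration is Safe;
-- the four Obstructions are exactly the ways it could.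
Safe : {X : Set} → (X → X → Set) → X → X → X → X → Set
Safe R a b c e = ¬ R a b × ¬ R c e × ¬ (R c a × R b e) × ¬ (R c b × R a e)

Obstruction : {X : Set} → (X → X → Set) → X → X → X → X → Set
Obstruction R a b c e = R a b ⊎ R c e ⊎ (R c a × R b e) ⊎ (R c b × R a e)

-- The five candidate windows, indexed by positions z 0, z 1, … of the ends
-- around a vertex, with a free end at z 5.  For the windows i = 5, 0, 4, 3, 2
-- (pairs (i , i+5), (i+1 , i+3), (i+2 , i+4)) the free end is joined first
-- and the two other joins must be Safe.
SomeSafeWindow : {X : Set} → (X → X → Set) → (ℕ → X) → Set
SomeSafeWindow R z = Safe R (z 6) (z 8) (z 7) (z 9) ⊎ Safe R (z 1) (z 3) (z 2) (z 4) ⊎ Safe R (z 4) (z 9) (z 6) (z 8)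
                   ⊎ Safe R (z 3) (z 8) (z 4) (z 6) ⊎ Safe R (z 2) (z 7) (z 4) (z 6)

module WindowLemma {X : Set} (R : X → X → Set) (R? : ∀ x y → Dec (R x y))
                   (R-sym : ∀ {x y} → R x y → R y x) (R-fun : ∀ {x y z} → R x y → R x z → y ≡ z) where

  safe-or-obstructed : ∀ a b c e → Safe R a b c e ⊎ Obstruction R a b c e
  safe-or-obstructed a b c e
    with R? a b ⊎-dec R? c e ⊎-dec (R? c a ×-dec R? b e) ⊎-dec (R? c b ×-dec R? a e)
  ... | yes o  = inj₂ o
  ... | no ¬o = inj₁ (¬o ∘ inj₁ , ¬o ∘ inj₂ ∘ inj₁ , ¬o ∘ inj₂ ∘ inj₂ ∘ inj₁ , ¬o ∘ inj₂ ∘ inj₂ ∘ inj₂)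

  -- In each
  -- clause below, one obstruction per window is chosen and symmetry and
  -- functionality of R force two distinct positions to carry the same end.
  module Nine (z : ℕ → X) (apart : ∀ i j → T (inRange 9 i j) → z i ≢ z j) where

    all-obstructed-nine : Obstruction R (z 6) (z 8) (z 7) (z 9) → Obstruction R (z 1) (z 3) (z 2) (z 4) →
                          Obstruction R (z 4) (z 9) (z 6) (z 8) → Obstruction R (z 3) (z 8) (z 4) (z 6) →
                          Obstruction R (z 2) (z 7) (z 4) (z 6) → ⊥
    all-obstructed-nine (inj₁ r0x0) _ (inj₁ r2x0) (inj₁ r3x0) _ = apart 3 6 tt (R-fun (R-sym r3x0) (R-sym r0x0))
    all-obstructed-nine (inj₁ r0x0) _ (inj₁ r2x0) (inj₂ (inj₁ r3x0)) _ = apart 4 8 tt (R-fun (R-sym r3x0) r0x0)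
    all-obstructed-nine (inj₁ r0x0) _ (inj₁ r2x0) (inj₂ (inj₂ (inj₁ (r3x0 , r3x1)))) _ = apart 3 9 tt (R-fun r3x0 r2x0)
    all-obstructed-nine (inj₁ r0x0) _ (inj₁ r2x0) (inj₂ (inj₂ (inj₂ (r3x0 , r3x1)))) _ = apart 4 6 tt (R-fun (R-sym r3x0) (R-sym r0x0))
    all-obstructed-nine (inj₁ r0x0) _ (inj₂ (inj₁ r2x0)) (inj₁ r3x0) _ = apart 3 6 tt (R-fun (R-sym r3x0) (R-sym r0x0))
    all-obstructed-nine (inj₁ r0x0) _ (inj₂ (inj₁ r2x0)) (inj₂ (inj₁ r3x0)) _ = apart 4 8 tt (R-fun (R-sym r3x0) r0x0)
    all-obstructed-nine (inj₁ r0x0) (inj₁ r1x0) (inj₂ (inj₁ r2x0)) (inj₂ (inj₂ (inj₁ (r3x0 , r3x1)))) (inj₁ r4x0) = apart 1 4 tt (R-fun (R-sym r1x0) (R-sym r3x0))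
    all-obstructed-nine (inj₁ r0x0) (inj₂ (inj₁ r1x0)) (inj₂ (inj₁ r2x0)) (inj₂ (inj₂ (inj₁ (r3x0 , r3x1)))) (inj₁ r4x0) = apart 2 3 tt (R-fun (R-sym r1x0) r3x0)
    all-obstructed-nine (inj₁ r0x0) (inj₂ (inj₂ (inj₁ (r1x0 , r1x1)))) (inj₂ (inj₁ r2x0)) (inj₂ (inj₂ (inj₁ (r3x0 , r3x1)))) (inj₁ r4x0) = apart 1 7 tt (R-fun r1x0 r4x0)
    all-obstructed-nine (inj₁ r0x0) (inj₂ (inj₂ (inj₂ (r1x0 , r1x1)))) (inj₂ (inj₁ r2x0)) (inj₂ (inj₂ (inj₁ (r3x0 , r3x1)))) (inj₁ r4x0) = apart 2 4 tt (R-fun (R-sym r1x0) (R-sym r3x0))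
    all-obstructed-nine (inj₁ r0x0) _ (inj₂ (inj₁ r2x0)) (inj₂ (inj₂ (inj₁ (r3x0 , r3x1)))) (inj₂ (inj₁ r4x0)) = apart 4 8 tt (R-fun (R-sym r4x0) r0x0)
    all-obstructed-nine (inj₁ r0x0) _ (inj₂ (inj₁ r2x0)) (inj₂ (inj₂ (inj₁ (r3x0 , r3x1)))) (inj₂ (inj₂ (inj₁ (r4x0 , r4x1)))) = apart 7 8 tt (R-fun (R-sym r4x1) r0x0)
    all-obstructed-nine (inj₁ r0x0) _ (inj₂ (inj₁ r2x0)) (inj₂ (inj₂ (inj₁ (r3x0 , r3x1)))) (inj₂ (inj₂ (inj₂ (r4x0 , r4x1)))) = apart 2 8 tt (R-fun (R-sym r4x1) r0x0)
    all-obstructed-nine (inj₁ r0x0) _ (inj₂ (inj₁ r2x0)) (inj₂ (inj₂ (inj₂ (r3x0 , r3x1)))) _ = apart 4 6 tt (R-fun (R-sym r3x0) (R-sym r0x0))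
    all-obstructed-nine (inj₁ r0x0) _ (inj₂ (inj₂ (inj₁ (r2x0 , r2x1)))) _ _ = apart 4 8 tt (R-fun r2x0 r0x0)
    all-obstructed-nine (inj₁ r0x0) _ (inj₂ (inj₂ (inj₂ (r2x0 , r2x1)))) _ _ = apart 8 9 tt (R-fun r0x0 r2x0)
    all-obstructed-nine (inj₂ (inj₁ r0x0)) _ (inj₁ r2x0) _ _ = apart 4 7 tt (R-fun (R-sym r2x0) (R-sym r0x0))
    all-obstructed-nine (inj₂ (inj₁ r0x0)) _ (inj₂ (inj₁ r2x0)) (inj₁ r3x0) _ = apart 3 6 tt (R-fun (R-sym r3x0) (R-sym r2x0))
    all-obstructed-nine (inj₂ (inj₁ r0x0)) _ (inj₂ (inj₁ r2x0)) (inj₂ (inj₁ r3x0)) _ = apart 4 8 tt (R-fun (R-sym r3x0) r2x0)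
    all-obstructed-nine (inj₂ (inj₁ r0x0)) _ (inj₂ (inj₁ r2x0)) (inj₂ (inj₂ (inj₁ (r3x0 , r3x1)))) (inj₁ r4x0) = apart 2 9 tt (R-fun (R-sym r4x0) r0x0)
    all-obstructed-nine (inj₂ (inj₁ r0x0)) _ (inj₂ (inj₁ r2x0)) (inj₂ (inj₂ (inj₁ (r3x0 , r3x1)))) (inj₂ (inj₁ r4x0)) = apart 4 8 tt (R-fun (R-sym r4x0) r2x0)
    all-obstructed-nine (inj₂ (inj₁ r0x0)) _ (inj₂ (inj₁ r2x0)) (inj₂ (inj₂ (inj₁ (r3x0 , r3x1)))) (inj₂ (inj₂ (inj₁ (r4x0 , r4x1)))) = apart 6 9 tt (R-fun r4x1 r0x0)
    all-obstructed-nine (inj₂ (inj₁ r0x0)) _ (inj₂ (inj₁ r2x0)) (inj₂ (inj₂ (inj₁ (r3x0 , r3x1)))) (inj₂ (inj₂ (inj₂ (r4x0 , r4x1)))) = apart 4 9 tt (R-fun (R-sym r4x0) r0x0)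
    all-obstructed-nine (inj₂ (inj₁ r0x0)) _ (inj₂ (inj₁ r2x0)) (inj₂ (inj₂ (inj₂ (r3x0 , r3x1)))) _ = apart 4 6 tt (R-fun (R-sym r3x0) (R-sym r2x0))
    all-obstructed-nine (inj₂ (inj₁ r0x0)) _ (inj₂ (inj₂ (inj₁ (r2x0 , r2x1)))) _ _ = apart 7 8 tt (R-fun (R-sym r0x0) r2x1)
    all-obstructed-nine (inj₂ (inj₁ r0x0)) _ (inj₂ (inj₂ (inj₂ (r2x0 , r2x1)))) _ _ = apart 6 7 tt (R-fun (R-sym r2x0) (R-sym r0x0))
    all-obstructed-nine (inj₂ (inj₂ (inj₁ (r0x0 , r0x1)))) _ (inj₁ r2x0) _ _ = apart 4 8 tt (R-fun (R-sym r2x0) (R-sym r0x1))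
    all-obstructed-nine (inj₂ (inj₂ (inj₁ (r0x0 , r0x1)))) _ (inj₂ (inj₁ r2x0)) _ _ = apart 7 8 tt (R-fun (R-sym r0x0) r2x0)
    all-obstructed-nine (inj₂ (inj₂ (inj₁ (r0x0 , r0x1)))) _ (inj₂ (inj₂ (inj₁ (r2x0 , r2x1)))) _ _ = apart 4 7 tt (R-fun r2x0 (R-sym r0x0))
    all-obstructed-nine (inj₂ (inj₂ (inj₁ (r0x0 , r0x1)))) _ (inj₂ (inj₂ (inj₂ (r2x0 , r2x1)))) _ _ = apart 7 9 tt (R-fun (R-sym r0x0) r2x0)
    all-obstructed-nine (inj₂ (inj₂ (inj₂ (r0x0 , r0x1)))) _ (inj₁ r2x0) _ _ = apart 4 6 tt (R-fun (R-sym r2x0) (R-sym r0x1))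
    all-obstructed-nine (inj₂ (inj₂ (inj₂ (r0x0 , r0x1)))) _ (inj₂ (inj₁ r2x0)) _ _ = apart 6 7 tt (R-fun (R-sym r2x0) (R-sym r0x0))
    all-obstructed-nine (inj₂ (inj₂ (inj₂ (r0x0 , r0x1)))) _ (inj₂ (inj₂ (inj₁ (r2x0 , r2x1)))) _ _ = apart 7 9 tt (R-fun (R-sym r0x0) (R-sym r2x1))
    all-obstructed-nine (inj₂ (inj₂ (inj₂ (r0x0 , r0x1)))) _ (inj₂ (inj₂ (inj₂ (r2x0 , r2x1)))) _ _ = apart 4 7 tt (R-fun (R-sym r2x1) (R-sym r0x0))

    safe-window-nine : SomeSafeWindow R z
    safe-window-nine with safe-or-obstructed (z 6) (z 8) (z 7) (z 9) | safe-or-obstructed (z 1) (z 3) (z 2) (z 4)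
                        | safe-or-obstructed (z 4) (z 9) (z 6) (z 8) | safe-or-obstructed (z 3) (z 8) (z 4) (z 6)
                        | safe-or-obstructed (z 2) (z 7) (z 4) (z 6)
    ... | inj₁ s | _     | _     | _     | _     = inj₁ s
    ... | inj₂ _ | inj₁ s | _     | _     | _     = inj₂ (inj₁ s)
    ... | inj₂ _ | inj₂ _ | inj₁ s | _     | _     = inj₂ (inj₂ (inj₁ s))
    ... | inj₂ _ | inj₂ _ | inj₂ _ | inj₁ s | _     = inj₂ (inj₂ (inj₂ (inj₁ s)))
    ... | inj₂ _ | inj₂ _ | inj₂ _ | inj₂ _ | inj₁ s = inj₂ (inj₂ (inj₂ (inj₂ s)))
    ... | inj₂ a | inj₂ b | inj₂ c | inj₂ d | inj₂ e = ⊥-elim (all-obstructed-nine a b c d e)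

  -- Degree 7: positions 1 … 7 carry distinct ends, and positions 8, 9 are
  -- positions 1, 2 again; the case analysis is as for degree ≥ 9.
  module Seven (z : ℕ → X) (apart : ∀ i j → T (inRange 7 i j) → z i ≢ z j)
               (z8≡z1 : z 8 ≡ z 1) (z9≡z2 : z 9 ≡ z 2) where

    all-obstructed-seven : Obstruction R (z 6) (z 1) (z 7) (z 2) → Obstruction R (z 1) (z 3) (z 2) (z 4) →
                           Obstruction R (z 4) (z 2) (z 6) (z 1) → Obstruction R (z 3) (z 1) (z 4) (z 6) →
                           Obstruction R (z 2) (z 7) (z 4) (z 6) → ⊥
    all-obstructed-seven (inj₁ r0x0) (inj₁ r1x0) _ _ _ = apart 3 6 tt (R-fun r1x0 (R-sym r0x0))
    all-obstructed-seven (inj₁ r0x0) (inj₂ (inj₁ r1x0)) (inj₁ r2x0) (inj₁ r3x0) _ = apart 3 6 tt (R-fun (R-sym r3x0) (R-sym r0x0))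
    all-obstructed-seven (inj₁ r0x0) (inj₂ (inj₁ r1x0)) (inj₁ r2x0) (inj₂ (inj₁ r3x0)) _ = apart 1 4 tt (R-fun r0x0 (R-sym r3x0))
    all-obstructed-seven (inj₁ r0x0) (inj₂ (inj₁ r1x0)) (inj₁ r2x0) (inj₂ (inj₂ (inj₁ (r3x0 , r3x1)))) _ = apart 2 3 tt (R-fun (R-sym r1x0) r3x0)
    all-obstructed-seven (inj₁ r0x0) (inj₂ (inj₁ r1x0)) (inj₁ r2x0) (inj₂ (inj₂ (inj₂ (r3x0 , r3x1)))) _ = apart 4 6 tt (R-fun (R-sym r3x0) (R-sym r0x0))
    all-obstructed-seven (inj₁ r0x0) (inj₂ (inj₁ r1x0)) (inj₂ (inj₁ r2x0)) (inj₁ r3x0) _ = apart 3 6 tt (R-fun (R-sym r3x0) (R-sym r0x0))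
    all-obstructed-seven (inj₁ r0x0) (inj₂ (inj₁ r1x0)) (inj₂ (inj₁ r2x0)) (inj₂ (inj₁ r3x0)) _ = apart 1 4 tt (R-fun r0x0 (R-sym r3x0))
    all-obstructed-seven (inj₁ r0x0) (inj₂ (inj₁ r1x0)) (inj₂ (inj₁ r2x0)) (inj₂ (inj₂ (inj₁ (r3x0 , r3x1)))) _ = apart 2 3 tt (R-fun (R-sym r1x0) r3x0)
    all-obstructed-seven (inj₁ r0x0) (inj₂ (inj₁ r1x0)) (inj₂ (inj₁ r2x0)) (inj₂ (inj₂ (inj₂ (r3x0 , r3x1)))) _ = apart 4 6 tt (R-fun (R-sym r3x0) (R-sym r0x0))
    all-obstructed-seven (inj₁ r0x0) (inj₂ (inj₁ r1x0)) (inj₂ (inj₂ (inj₁ (r2x0 , r2x1)))) _ _ = apart 1 4 tt (R-fun r0x0 r2x0)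
    all-obstructed-seven (inj₁ r0x0) (inj₂ (inj₁ r1x0)) (inj₂ (inj₂ (inj₂ (r2x0 , r2x1)))) _ _ = apart 1 2 tt (R-fun r0x0 r2x0)
    all-obstructed-seven (inj₁ r0x0) (inj₂ (inj₂ (inj₁ (r1x0 , r1x1)))) _ _ _ = apart 2 6 tt (R-fun (R-sym r1x0) (R-sym r0x0))
    all-obstructed-seven (inj₁ r0x0) (inj₂ (inj₂ (inj₂ (r1x0 , r1x1)))) _ _ _ = apart 4 6 tt (R-fun r1x1 (R-sym r0x0))
    all-obstructed-seven (inj₂ (inj₁ r0x0)) (inj₁ r1x0) (inj₁ r2x0) _ _ = apart 4 7 tt (R-fun (R-sym r2x0) (R-sym r0x0))
    all-obstructed-seven (inj₂ (inj₁ r0x0)) (inj₁ r1x0) (inj₂ (inj₁ r2x0)) _ _ = apart 3 6 tt (R-fun r1x0 (R-sym r2x0))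
    all-obstructed-seven (inj₂ (inj₁ r0x0)) (inj₁ r1x0) (inj₂ (inj₂ (inj₁ (r2x0 , r2x1)))) _ _ = apart 1 7 tt (R-fun r2x1 (R-sym r0x0))
    all-obstructed-seven (inj₂ (inj₁ r0x0)) (inj₁ r1x0) (inj₂ (inj₂ (inj₂ (r2x0 , r2x1)))) _ _ = apart 6 7 tt (R-fun (R-sym r2x0) (R-sym r0x0))
    all-obstructed-seven (inj₂ (inj₁ r0x0)) (inj₂ (inj₁ r1x0)) _ _ _ = apart 4 7 tt (R-fun r1x0 (R-sym r0x0))
    all-obstructed-seven (inj₂ (inj₁ r0x0)) (inj₂ (inj₂ (inj₁ (r1x0 , r1x1)))) _ _ _ = apart 1 7 tt (R-fun r1x0 (R-sym r0x0))
    all-obstructed-seven (inj₂ (inj₁ r0x0)) (inj₂ (inj₂ (inj₂ (r1x0 , r1x1)))) _ _ _ = apart 3 7 tt (R-fun r1x0 (R-sym r0x0))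
    all-obstructed-seven (inj₂ (inj₂ (inj₁ (r0x0 , r0x1)))) (inj₁ r1x0) _ _ _ = apart 2 3 tt (R-fun r0x1 r1x0)
    all-obstructed-seven (inj₂ (inj₂ (inj₁ (r0x0 , r0x1)))) (inj₂ (inj₁ r1x0)) _ _ _ = apart 1 4 tt (R-fun (R-sym r0x1) r1x0)
    all-obstructed-seven (inj₂ (inj₂ (inj₁ (r0x0 , r0x1)))) (inj₂ (inj₂ (inj₁ (r1x0 , r1x1)))) (inj₁ r2x0) _ _ = apart 1 4 tt (R-fun (R-sym r0x1) (R-sym r2x0))
    all-obstructed-seven (inj₂ (inj₂ (inj₁ (r0x0 , r0x1)))) (inj₂ (inj₂ (inj₁ (r1x0 , r1x1)))) (inj₂ (inj₁ r2x0)) _ _ = apart 1 7 tt (R-fun r2x0 (R-sym r0x0))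
    all-obstructed-seven (inj₂ (inj₂ (inj₁ (r0x0 , r0x1)))) (inj₂ (inj₂ (inj₁ (r1x0 , r1x1)))) (inj₂ (inj₂ (inj₁ (r2x0 , r2x1)))) _ _ = apart 4 7 tt (R-fun r2x0 (R-sym r0x0))
    all-obstructed-seven (inj₂ (inj₂ (inj₁ (r0x0 , r0x1)))) (inj₂ (inj₂ (inj₁ (r1x0 , r1x1)))) (inj₂ (inj₂ (inj₂ (r2x0 , r2x1)))) _ _ = apart 2 7 tt (R-fun r2x0 (R-sym r0x0))
    all-obstructed-seven (inj₂ (inj₂ (inj₁ (r0x0 , r0x1)))) (inj₂ (inj₂ (inj₂ (r1x0 , r1x1)))) _ _ _ = apart 1 3 tt (R-fun (R-sym r0x1) r1x0)
    all-obstructed-seven (inj₂ (inj₂ (inj₂ (r0x0 , r0x1)))) (inj₁ r1x0) _ _ _ = apart 3 7 tt (R-fun r1x0 (R-sym r0x0))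
    all-obstructed-seven (inj₂ (inj₂ (inj₂ (r0x0 , r0x1)))) (inj₂ (inj₁ r1x0)) _ _ _ = apart 4 6 tt (R-fun r1x0 (R-sym r0x1))
    all-obstructed-seven (inj₂ (inj₂ (inj₂ (r0x0 , r0x1)))) (inj₂ (inj₂ (inj₁ (r1x0 , r1x1)))) _ _ _ = apart 2 7 tt (R-fun (R-sym r1x0) (R-sym r0x0))
    all-obstructed-seven (inj₂ (inj₂ (inj₂ (r0x0 , r0x1)))) (inj₂ (inj₂ (inj₂ (r1x0 , r1x1)))) _ _ _ = apart 4 7 tt (R-fun r1x1 (R-sym r0x0))

    safe-window-seven : SomeSafeWindow R z
    safe-window-seven
      rewrite z8≡z1 | z9≡z2
      with safe-or-obstructed (z 6) (z 1) (z 7) (z 2) | safe-or-obstructed (z 1) (z 3) (z 2) (z 4)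
         | safe-or-obstructed (z 4) (z 2) (z 6) (z 1) | safe-or-obstructed (z 3) (z 1) (z 4) (z 6)
         | safe-or-obstructed (z 2) (z 7) (z 4) (z 6)
    ... | inj₁ s | _     | _     | _     | _     = inj₁ s
    ... | inj₂ _ | inj₁ s | _     | _     | _     = inj₂ (inj₁ s)
    ... | inj₂ _ | inj₂ _ | inj₁ s | _     | _     = inj₂ (inj₂ (inj₁ s))
    ... | inj₂ _ | inj₂ _ | inj₂ _ | inj₁ s | _     = inj₂ (inj₂ (inj₂ (inj₁ s)))
    ... | inj₂ _ | inj₂ _ | inj₂ _ | inj₂ _ | inj₁ s = inj₂ (inj₂ (inj₂ (inj₂ s)))
    ... | inj₂ a | inj₂ b | inj₂ c | inj₂ d | inj₂ e = ⊥-elim (all-obstructed-seven a b c d e)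

-- Oriented trail segments of a map

module Segments (M : AbstractMap) where
  open AbstractMap M

  -- An end of a segment: a position at a vertex, or nothing for the free end
  -- of a half-edge.
  End : Set
  End = Maybe Position

  _≟ᴱ_ : DecidableEquality End
  _≟ᴱ_ = Maybeₚ.≡-dec (Productₚ.≡-dec Finₚ._≟_ Finₚ._≟_)

  position-injective : ∀ {v} {x y : Fin (deg v)} → _≡_ {A = Position} (v , x) (v , y) → x ≡ y
  position-injective refl = refl

  -- An edge together with a direction of traversal: it is entered at src and
  -- left at tgt, and these are all its ends.
  record OrientedEdge : Set where
    field
      edge       : Fin m
      src tgt    : End
      src-ok     : ∀ {p} → src ≡ just p → edgeAt p ≡ edge
      tgt-ok     : ∀ {p} → tgt ≡ just p → edgeAt p ≡ edge
      src≢tgt    : src ≢ tgt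
      src-or-tgt : ∀ p → edgeAt p ≡ edge → src ≡ just p ⊎ tgt ≡ just p
  open OrientedEdge

  reverseEdge : OrientedEdge → OrientedEdge
  reverseEdge o = record
    { edge = edge o ; src = tgt o ; tgt = src o ; src-ok = tgt-ok o ; tgt-ok = src-ok o
    ; src≢tgt = src≢tgt o ∘ sym ; src-or-tgt = λ p eq → Sum.swap (src-or-tgt o p eq) }

  -- A passage through vertex w, leaving one edge by the end x and entering the
  -- next one by the end y.
  Link : Set
  Link = Σ (Fin n) λ w → Fin (deg w) × Fin (deg w)

  swapLink : Link → Link
  swapLink (w , x , y) = w , y , x

  data Segment : End → End → Set where
    single : (o : OrientedEdge) {fr bk : End} → src o ≡ fr → tgt o ≡ bk → Segment fr bk
    cons   : (o : OrientedEdge) {fr bk : End} (w : Fin n) (x y : Fin (deg w)) → src o ≡ fr →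
             tgt o ≡ just (w , x) → Segment (just (w , y)) bk → Segment fr bk

  edges : ∀ {fr bk} → Segment fr bk → List (Fin m)
  edges (single o _ _)         = edge o ∷ []
  edges (cons o _ _ _ _ _ T)   = edge o ∷ edges T

  steps : ∀ {fr bk} → Segment fr bk → List OrientedEdge
  steps (single o _ _)         = o ∷ []
  steps (cons o _ _ _ _ _ T)   = o ∷ steps T

  links : ∀ {fr bk} → Segment fr bk → List Link
  links (single o _ _)         = []
  links (cons o w x y _ _ T)   = (w , x , y) ∷ links T

  join : ∀ {fr bk w} {x y : Fin (deg w)} → Segment fr (just (w , x)) → Segment (just (w , y)) bk → Segment fr bk
  join {w = w} {x} {y} (single o p q) T = cons o w x y p q T
  join (cons o w′ x′ y′ p q T₁) T₂     = cons o w′ x′ y′ p q (join T₁ T₂)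

  reverse : ∀ {fr bk} → Segment fr bk → Segment bk fr
  reverse (single o p q)       = single (reverseEdge o) q p
  reverse (cons o w x y p q T) = join (reverse T) (single (reverseEdge o) q p)

  edges-join : ∀ {fr bk w} {x y : Fin (deg w)} (T₁ : Segment fr (just (w , x))) (T₂ : Segment (just (w , y)) bk) →
               edges (join T₁ T₂) ≡ edges T₁ ++ edges T₂
  edges-join (single o p q)           T₂ = refl
  edges-join (cons o w′ x′ y′ p q T₁) T₂ = cong (edge o ∷_) (edges-join T₁ T₂)

  links-join : ∀ {fr bk w} {x y : Fin (deg w)} (T₁ : Segment fr (just (w , x))) (T₂ : Segment (just (w , y)) bk) →
               links (join T₁ T₂) ≡ links T₁ ++ (w , x , y) ∷ links T₂
  links-join (single o p q)           T₂ = refl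
  links-join (cons o w′ x′ y′ p q T₁) T₂ = cong ((w′ , x′ , y′) ∷_) (links-join T₁ T₂)

  edges-reverse : ∀ {fr bk} (T : Segment fr bk) → edges (reverse T) ↭ edges T
  edges-reverse (single o p q)       = ↭-refl
  edges-reverse (cons o w x y p q T) rewrite edges-join (reverse T) (single (reverseEdge o) q p) =
    ↭-trans (++⁺ʳ [ edge o ] (edges-reverse T)) (++-comm (edges T) [ edge o ])

  links-reverse⁺ : ∀ {fr bk} (T : Segment fr bk) {l} → l ∈ links T → swapLink l ∈ links (reverse T)
  links-reverse⁺ (cons o w x y p q T) l∈ rewrite links-join (reverse T) (single (reverseEdge o) q p) with l∈
  ... | here refl = ∈-++⁺ʳ (links (reverse T)) (here refl)
  ... | there l∈′ = ∈-++⁺ˡ (links-reverse⁺ T l∈′)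

  links-reverse⁻ : ∀ {fr bk} (T : Segment fr bk) {l} → l ∈ links (reverse T) → swapLink l ∈ links T
  links-reverse⁻ (cons o w x y p q T) l∈ rewrite links-join (reverse T) (single (reverseEdge o) q p)
    with ∈-++⁻ (links (reverse T)) l∈
  ... | inj₁ l∈′        = there (links-reverse⁻ T l∈′)
  ... | inj₂ (here refl) = here refl

  OnLink : Position → Link → Set
  OnLink p (w , x , y) = p ≡ (w , x) ⊎ p ≡ (w , y)

  end-or-link : ∀ {fr bk} (T : Segment fr bk) {o p} → o ∈ steps T → (src o ≡ just p ⊎ tgt o ≡ just p) →
                fr ≡ just p ⊎ bk ≡ just p ⊎ ∃[ l ] (l ∈ links T × OnLink p l)
  end-or-link (single o′ p′ q′) (here refl) (inj₁ eq) = inj₁ (trans (sym p′) eq)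
  end-or-link (single o′ p′ q′) (here refl) (inj₂ eq) = inj₂ (inj₁ (trans (sym q′) eq))
  end-or-link (cons o′ w x y p′ q′ T) (here refl) (inj₁ eq) = inj₁ (trans (sym p′) eq)
  end-or-link (cons o′ w x y p′ q′ T) (here refl) (inj₂ eq) =
    inj₂ (inj₂ ((w , x , y) , here refl , inj₁ (Maybeₚ.just-injective (trans (sym eq) q′))))
  end-or-link (cons o′ w x y p′ q′ T) (there o∈) ends with end-or-link T o∈ ends
  ... | inj₁ eq                   = inj₂ (inj₂ ((w , x , y) , here refl , inj₂ (sym (Maybeₚ.just-injective eq))))
  ... | inj₂ (inj₁ eq)            = inj₂ (inj₁ eq)
  ... | inj₂ (inj₂ (l , l∈ , on)) = inj₂ (inj₂ (l , there l∈ , on))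

  edge∈steps : ∀ {fr bk} (T : Segment fr bk) {e} → e ∈ edges T → ∃[ o ] (o ∈ steps T × edge o ≡ e)
  edge∈steps (single o _ _)       (here refl) = o , here refl , refl
  edge∈steps (cons o _ _ _ _ _ T) (here refl) = o , here refl , refl
  edge∈steps (cons o _ _ _ _ _ T) (there e∈) with edge∈steps T e∈
  ... | o′ , o∈ , eq = o′ , there o∈ , eq

  front-edge : ∀ {fr bk} (T : Segment fr bk) {p} → fr ≡ just p → edgeAt p ∈ edges T
  front-edge (single o p′ q′)       eq = here (src-ok o (trans p′ eq))
  front-edge (cons o w x y p′ q′ T) eq = here (src-ok o (trans p′ eq))

  back-edge : ∀ {fr bk} (T : Segment fr bk) {p} → bk ≡ just p → edgeAt p ∈ edges T
  back-edge (single o p′ q′)       eq = here (tgt-ok o (trans q′ eq))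
  back-edge (cons o w x y p′ q′ T) eq = there (back-edge T eq)

  front≢back : ∀ {fr bk} (T : Segment fr bk) → Distinct (edges T) → ∀ {p} → fr ≡ just p → bk ≡ just p → ⊥
  front≢back (single o p′ q′)       u        e₁ e₂ = src≢tgt o (trans p′ (trans e₁ (trans (sym e₂) (sym q′))))
  front≢back (cons o w x y p′ q′ T) (e∉ , u) e₁ e₂ =
    e∉ (subst (_∈ edges T) (src-ok o (trans p′ e₁)) (back-edge T e₂))

  module AsTrail where

    len : ∀ {fr bk} → Segment fr bk → ℕ
    len (single _ _ _)         = 0
    len (cons _ _ _ _ _ _ T)   = suc (len T)

    edgeOf : ∀ {fr bk} (T : Segment fr bk) → Fin (suc (len T)) → Fin m
    edgeOf (single o _ _)       _        = edge o
    edgeOf (cons o _ _ _ _ _ T) fzero    = edge o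
    edgeOf (cons o _ _ _ _ _ T) (fsuc i) = edgeOf T i

    vertexOf : ∀ {fr bk} (T : Segment fr bk) → Fin (len T) → Fin n
    vertexOf (cons o w x y _ _ T) fzero    = w
    vertexOf (cons o w x y _ _ T) (fsuc i) = vertexOf T i

    outOf : ∀ {fr bk} (T : Segment fr bk) (i : Fin (len T)) → Fin (deg (vertexOf T i))
    outOf (cons o w x y _ _ T) fzero    = x
    outOf (cons o w x y _ _ T) (fsuc i) = outOf T i

    innOf : ∀ {fr bk} (T : Segment fr bk) (i : Fin (len T)) → Fin (deg (vertexOf T i))
    innOf (cons o w x y _ _ T) fzero    = y
    innOf (cons o w x y _ _ T) (fsuc i) = innOf T i

    first-edge : ∀ {p bk} (T : Segment (just p) bk) → edgeAt p ≡ edgeOf T fzero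
    first-edge (single o p′ q′)       = src-ok o p′
    first-edge (cons o w x y p′ q′ T) = src-ok o p′

    out-ok : ∀ {fr bk} (T : Segment fr bk) (i : Fin (len T)) → φ (vertexOf T i) (outOf T i) ≡ edgeOf T (inject₁ i)
    out-ok (cons o w x y p q T) fzero    = tgt-ok o q
    out-ok (cons o w x y p q T) (fsuc i) = out-ok T i

    inn-ok : ∀ {fr bk} (T : Segment fr bk) (i : Fin (len T)) → φ (vertexOf T i) (innOf T i) ≡ edgeOf T (fsuc i)
    inn-ok (cons o w x y p q T) fzero    = first-edge T
    inn-ok (cons o w x y p q T) (fsuc i) = inn-ok T i

    traverses : ∀ {fr bk} (T : Segment fr bk) (i j : Fin (len T)) → fsuc i ≡ inject₁ j →
                _≢_ {A = Position} (vertexOf T i , innOf T i) (vertexOf T j , outOf T j)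
    traverses (cons o w x y p q (cons o′ w′ x′ y′ p′ q′ T)) fzero (fsuc fzero) _ eq =
      src≢tgt o′ (trans p′ (trans (cong just eq) (sym q′)))
    traverses (cons o w x y p q T) (fsuc i) (fsuc j) eq = traverses T i j (Finₚ.suc-injective eq)
    traverses (cons o w x y p q T) fzero fzero ()
    traverses (cons o w x y p q T) (fsuc i) fzero ()
    traverses (cons o w x y p q (cons _ _ _ _ _ _ T)) fzero (fsuc (fsuc j)) ()

    edgeOf-∈ : ∀ {fr bk} (T : Segment fr bk) i → edgeOf T i ∈ edges T
    edgeOf-∈ (single o _ _)       fzero    = here refl
    edgeOf-∈ (cons o _ _ _ _ _ T) fzero    = here refl
    edgeOf-∈ (cons o _ _ _ _ _ T) (fsuc i) = there (edgeOf-∈ T i)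

    ∈-edgeOf : ∀ {fr bk} (T : Segment fr bk) {e} → e ∈ edges T → ∃[ i ] edgeOf T i ≡ e
    ∈-edgeOf (single o _ _)       (here refl) = fzero , refl
    ∈-edgeOf (cons o _ _ _ _ _ T) (here refl) = fzero , refl
    ∈-edgeOf (cons o _ _ _ _ _ T) (there e∈) with ∈-edgeOf T e∈
    ... | i , eq = fsuc i , eq

    edgeOf-injective : ∀ {fr bk} (T : Segment fr bk) → Distinct (edges T) →
                       (i j : Fin (suc (len T))) → edgeOf T i ≡ edgeOf T j → i ≡ j
    edgeOf-injective (single o _ _)       u        fzero    fzero    _  = refl
    edgeOf-injective (cons o _ _ _ _ _ T) u        fzero    fzero    _  = refl
    edgeOf-injective (cons o _ _ _ _ _ T) (e∉ , u) fzero    (fsuc j) eq = ⊥-elim (e∉ (subst (_∈ edges T) (sym eq) (edgeOf-∈ T j)))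
    edgeOf-injective (cons o _ _ _ _ _ T) (e∉ , u) (fsuc i) fzero    eq = ⊥-elim (e∉ (subst (_∈ edges T) eq (edgeOf-∈ T i)))
    edgeOf-injective (cons o _ _ _ _ _ T) (e∉ , u) (fsuc i) (fsuc j) eq = cong fsuc (edgeOf-injective T u i j eq)

    toTrail : ∀ {fr bk} (T : Segment fr bk) → Distinct (edges T) → Trail M
    toTrail T u = record
      { k = len T ; edge = edgeOf T ; distinct = edgeOf-injective T u ; tv = vertexOf T ; out = outOf T
      ; inn = innOf T ; out-ok = out-ok T ; inn-ok = inn-ok T ; traverse = traverses T }

    link-index : ∀ {fr bk} (T : Segment fr bk) {w} {x y : Fin (deg w)} → (w , x , y) ∈ links T →
                 ∃[ t ] (_≡_ {A = Link} (vertexOf T t , outOf T t , innOf T t) (w , x , y))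
    link-index (cons o w x y p q T) (here refl) = fzero , refl
    link-index (cons o w x y p q T) (there l∈) with link-index T l∈
    ... | t , eq = fsuc t , eq

    link-consecutive : ∀ {fr bk} (T : Segment fr bk) (u : Distinct (edges T)) {w} {x y : Fin (deg w)} {a c : ℕ} →
                       (w , x , y) ∈ links T → Rep M w a x → Rep M w c y → ConsecutiveIn M (toTrail T u) w a c
    link-consecutive T u l∈ ra rc with link-index T l∈
    ... | t , refl = t , refl , inj₁ (ra , rc)

-- Systems of segments and merging

-- A system is a list of pieces (segments with their ends).  It is valid for
-- a list `used` of positions when its edges are distinct, cover the map, and
-- every link passes through positions in `used`; so an unused position is an
-- end of some piece.  Joining two pieces at unused ends keeps it valid.
module Systems (M : AbstractMap) where
  open AbstractMap M
  open Segments M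
  open OrientedEdge

  Piece : Set
  Piece = Σ End λ fr → Σ End λ bk → Segment fr bk

  edgesOf : Piece → List (Fin m)
  edgesOf (_ , _ , T) = edges T

  linksOf : Piece → List Link
  linksOf (_ , _ , T) = links T

  allEdges : List Piece → List (Fin m)
  allEdges []      = []
  allEdges (t ∷ S) = edgesOf t ++ allEdges S

  allEdges-↭ : ∀ {S S′} → S ↭ S′ → allEdges S ↭ allEdges S′
  allEdges-↭ Perm.refl           = ↭-refl
  allEdges-↭ (Perm.prep t p)     = ++⁺ˡ (edgesOf t) (allEdges-↭ p)
  allEdges-↭ (Perm.swap t t′ p)  =
    ↭-trans (shifts (edgesOf t) (edgesOf t′)) (++⁺ˡ (edgesOf t′) (++⁺ˡ (edgesOf t) (allEdges-↭ p)))
  allEdges-↭ (Perm.trans p q)    = ↭-trans (allEdges-↭ p) (allEdges-↭ q)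

  ∈-allEdges⁻ : ∀ S {e} → e ∈ allEdges S → ∃[ t ] (t ∈ S × e ∈ edgesOf t)
  ∈-allEdges⁻ (t ∷ S) e∈ with ∈-++⁻ (edgesOf t) e∈
  ... | inj₁ p = t , here refl , p
  ... | inj₂ p with ∈-allEdges⁻ S p
  ... | t′ , t∈ , q = t′ , there t∈ , q

  ∈-allEdges⁺ : ∀ S {e t} → t ∈ S → e ∈ edgesOf t → e ∈ allEdges S
  ∈-allEdges⁺ (t ∷ S) (here refl) p = ∈-++⁺ˡ p
  ∈-allEdges⁺ (t ∷ S) (there t∈)  p = ∈-++⁺ʳ (edgesOf t) (∈-allEdges⁺ S t∈ p)

  IsEnd : Position → Piece → Set
  IsEnd p (fr , bk , _) = fr ≡ just p ⊎ bk ≡ just p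

  EndsOf : Position → Position → Piece → Set
  EndsOf p q (fr , bk , _) = (fr ≡ just p × bk ≡ just q) ⊎ (fr ≡ just q × bk ≡ just p)

  -- p and q are the two ends of one piece of S: joining them would close it.
  Bound : List Piece → Position → Position → Set
  Bound S p q = Any (EndsOf p q) S

  HasLink : List Piece → Link → Set
  HasLink S l = Any (λ t → l ∈ linksOf t ⊎ swapLink l ∈ linksOf t) S

  record Valid (S : List Piece) (used : List Position) : Set where
    field
      distinct   : Distinct (allEdges S)
      covers     : ∀ e → e ∈ allEdges S
      links-used : ∀ {t} → t ∈ S → ∀ {l} → l ∈ linksOf t → ∀ {p} → OnLink p l → p ∈ used
  open Valid

  pick : ∀ {P : Piece → Set} {S} → Any P S → ∃[ t ] (P t × ∃[ S′ ] (S ↭ t ∷ S′))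
  pick (here {x = t} {xs = S′} pt) = t , pt , S′ , ↭-refl
  pick (there {x = x} a) with pick a
  ... | t , pt , S′ , p = t , pt , x ∷ S′ , ↭-trans (prep x p) (swap x t ↭-refl)

  isEnd-edge : ∀ t {p} → IsEnd p t → edgeAt p ∈ edgesOf t
  isEnd-edge (fr , bk , T) (inj₁ eq) = front-edge T eq
  isEnd-edge (fr , bk , T) (inj₂ eq) = back-edge T eq

  unused-is-end : ∀ {S used} → Valid S used → ∀ {p} → p ∉ used → Any (IsEnd p) S
  unused-is-end {S} V {p} p∉ with ∈-allEdges⁻ S (covers V (edgeAt p))
  ... | t@(fr , bk , T) , t∈ , e∈ with edge∈steps T e∈
  ... | o , o∈ , eo with end-or-link T o∈ (src-or-tgt o p (sym eo))
  ... | inj₁ eq                   = Any.map (λ { refl → inj₁ eq }) t∈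
  ... | inj₂ (inj₁ eq)            = Any.map (λ { refl → inj₂ eq }) t∈
  ... | inj₂ (inj₂ (l , l∈ , on)) = ⊥-elim (p∉ (links-used V t∈ l∈ on))

  ends-isEnd : ∀ t {p q} → EndsOf p q t → IsEnd p t
  ends-isEnd t (inj₁ (e₁ , _)) = inj₁ e₁
  ends-isEnd t (inj₂ (_ , e₂)) = inj₂ e₂

  bound-end : ∀ {S p q} → Bound S p q → Any (IsEnd p) S
  bound-end = Any.map (λ {t} → ends-isEnd t)

  any-end-edge : ∀ S {p} → Any (IsEnd p) S → edgeAt p ∈ allEdges S
  any-end-edge (t ∷ S) (here e)  = ∈-++⁺ˡ (isEnd-edge t e)
  any-end-edge (t ∷ S) (there a) = ∈-++⁺ʳ (edgesOf t) (any-end-edge S a)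

  bound-sym : ∀ {S p q} → Bound S p q → Bound S q p
  bound-sym = Any.map λ { (inj₁ x) → inj₂ x ; (inj₂ x) → inj₁ x }

  bound-functional : ∀ S → Distinct (allEdges S) → ∀ {p q r} → Bound S p q → Bound S p r → q ≡ r
  bound-functional (t ∷ S) u (here a)  (here b)  = ends-functional t a b
    where
    jinj = Maybeₚ.just-injective
    ends-functional : ∀ t {p q r} → EndsOf p q t → EndsOf p r t → q ≡ r
    ends-functional t (inj₁ (a₁ , a₂)) (inj₁ (b₁ , b₂)) = jinj (trans (sym a₂) b₂)
    ends-functional t (inj₁ (a₁ , a₂)) (inj₂ (b₁ , b₂)) = trans (jinj (trans (sym a₂) b₂)) (jinj (trans (sym a₁) b₁))
    ends-functional t (inj₂ (a₁ , a₂)) (inj₁ (b₁ , b₂)) = trans (jinj (trans (sym a₁) b₁)) (jinj (trans (sym a₂) b₂))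
    ends-functional t (inj₂ (a₁ , a₂)) (inj₂ (b₁ , b₂)) = jinj (trans (sym a₁) b₁)
  bound-functional (t ∷ S) u (here a)  (there b) =
    ⊥-elim (distinct-++-disjoint (edgesOf t) (allEdges S) u (isEnd-edge t (ends-isEnd t a)) (any-end-edge S (bound-end b)))
  bound-functional (t ∷ S) u (there a) (here b)  =
    ⊥-elim (distinct-++-disjoint (edgesOf t) (allEdges S) u (isEnd-edge t (ends-isEnd t b)) (any-end-edge S (bound-end a)))
  bound-functional (t ∷ S) u (there a) (there b) = bound-functional S (distinct-++ʳ (edgesOf t) (allEdges S) u) a b

  bound-irreflexive : ∀ S → Distinct (allEdges S) → ∀ {p} → Bound S p p → ⊥
  bound-irreflexive ((fr , bk , T) ∷ S) u (here (inj₁ (e₁ , e₂))) = front≢back T (distinct-++ˡ (edges T) (allEdges S) u) e₁ e₂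
  bound-irreflexive ((fr , bk , T) ∷ S) u (here (inj₂ (e₁ , e₂))) = front≢back T (distinct-++ˡ (edges T) (allEdges S) u) e₁ e₂
  bound-irreflexive (t ∷ S)             u (there a)                = bound-irreflexive S (distinct-++ʳ (edgesOf t) (allEdges S) u) a

  bound? : ∀ S p q → Dec (Bound S p q)
  bound? S p q = Any.any? (λ { (fr , bk , _) → ((fr ≟ᴱ just p) ×-dec (bk ≟ᴱ just q)) ⊎-dec ((fr ≟ᴱ just q) ×-dec (bk ≟ᴱ just p)) }) S

  -- S′ is S with its pieces permuted or reversed: validity and links carry
  -- over to S′, and pairs of ends of S′ are pairs of ends of S.
  record Rearrangement (S S′ : List Piece) : Set where
    field
      valid : ∀ {used} → Valid S used → Valid S′ used
      bound : ∀ {p q} → Bound S′ p q → Bound S p q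
      hasLink : ∀ {l} → HasLink S l → HasLink S′ l
  open Rearrangement

  rearrangement-trans : ∀ {S S′ S″} → Rearrangement S S′ → Rearrangement S′ S″ → Rearrangement S S″
  rearrangement-trans E F = record
    { valid = valid F ∘ valid E ; bound = bound E ∘ bound F ; hasLink = hasLink F ∘ hasLink E }

  permute : ∀ {S S′} → S ↭ S′ → Rearrangement S S′
  permute p = record
    { valid = λ V → record
        { distinct   = distinct-resp-↭ (allEdges-↭ p) (distinct V)
        ; covers     = ∈-resp-↭ (allEdges-↭ p) ∘ covers V
        ; links-used = links-used V ∘ ∈-resp-↭ (↭-sym p) }
    ; bound   = Any-resp-↭ (↭-sym p)
    ; hasLink = Any-resp-↭ p }

  reverse-first : ∀ {fr bk} (T : Segment fr bk) S → Rearrangement ((fr , bk , T) ∷ S) ((bk , fr , reverse T) ∷ S)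
  reverse-first T S = record
    { valid = λ V → record
        { distinct   = distinct-resp-↭ edges↭ (distinct V)
        ; covers     = ∈-resp-↭ edges↭ ∘ covers V
        ; links-used = λ { (here refl) l∈ on → links-used V (here refl) (links-reverse⁻ T l∈) (on-swapped on)
                         ; (there t∈) → links-used V (there t∈) } }
    ; bound   = λ { (here (inj₁ (a , b))) → here (inj₂ (b , a)) ; (here (inj₂ (a , b))) → here (inj₁ (b , a))
                  ; (there a) → there a }
    ; hasLink = λ { (here (inj₁ l∈))   → here (inj₂ (links-reverse⁺ T l∈))
                  ; (here (inj₂ l′∈)) → here (inj₁ (subst (_∈ links (reverse T)) (swap-swap _) (links-reverse⁺ T l′∈)))
                  ; (there a)          → there a } }
    where
    edges↭ : allEdges ((_ , _ , T) ∷ S) ↭ allEdges ((_ , _ , reverse T) ∷ S)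
    edges↭ = ++⁺ʳ (allEdges S) (↭-sym (edges-reverse T))
    swap-swap : ∀ l → swapLink (swapLink l) ≡ l
    swap-swap (w , x , y) = refl
    on-swapped : ∀ {p} {l : Link} → OnLink p l → OnLink p (swapLink l)
    on-swapped {l = w , x , y} (inj₁ e) = inj₂ e
    on-swapped {l = w , x , y} (inj₂ e) = inj₁ e

  BoundAfterJoin : List Piece → List Piece → Position → Position → Set
  BoundAfterJoin S S′ a b = ∀ {p q} → Bound S′ p q →
    Bound S p q ⊎ (Bound S p a × Bound S b q) ⊎ (Bound S p b × Bound S a q)

  record Joined (S : List Piece) (used : List Position) (v : Fin n) (x y : Fin (deg v)) : Set where
    field
      S′       : List Piece
      valid′   : Valid S′ ((v , x) ∷ (v , y) ∷ used)
      newLink  : HasLink S′ (v , x , y)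
      keeps    : ∀ {l} → HasLink S l → HasLink S′ l
      boundVia : BoundAfterJoin S S′ (v , x) (v , y)

  joined-rearranged : ∀ {S S₁ used v} {x y : Fin (deg v)} → Rearrangement S S₁ → Joined S₁ used v x y → Joined S used v x y
  joined-rearranged E J = record
    { S′ = S′ ; valid′ = valid′ ; newLink = newLink ; keeps = keeps ∘ hasLink E
    ; boundVia = Sum.map (bound E) (Sum.map (Product.map (bound E) (bound E)) (Product.map (bound E) (bound E))) ∘ boundVia }
    where open Joined J

  join-first-two : ∀ {α β used v} {x y : Fin (deg v)} (TA : Segment α (just (v , x))) (TB : Segment (just (v , y)) β) S →
                   Valid ((α , just (v , x) , TA) ∷ (just (v , y) , β , TB) ∷ S) used →
                   Joined ((α , just (v , x) , TA) ∷ (just (v , y) , β , TB) ∷ S) used v x y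
  join-first-two {α} {β} {used} {v} {x} {y} TA TB S V = record
    { S′       = (α , β , join TA TB) ∷ S
    ; valid′   = record { distinct = subst Distinct edges≡ (distinct V) ; covers = λ e → subst (e ∈_) edges≡ (covers V e)
                        ; links-used = used′ }
    ; newLink  = here (inj₁ (joined-link (inj₂ (here refl))))
    ; keeps    = keeps
    ; boundVia = boundVia }
    where
    edges≡ : edges TA ++ (edges TB ++ allEdges S) ≡ edges (join TA TB) ++ allEdges S
    edges≡ = trans (sym (Listₚ.++-assoc (edges TA) (edges TB) (allEdges S))) (cong (_++ allEdges S) (sym (edges-join TA TB)))
    joined-link : ∀ {l} → l ∈ links TA ⊎ l ∈ (v , x , y) ∷ links TB → l ∈ links (join TA TB)
    joined-link {l} (inj₁ p) = subst (l ∈_) (sym (links-join TA TB)) (∈-++⁺ˡ p)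
    joined-link {l} (inj₂ p) = subst (l ∈_) (sym (links-join TA TB)) (∈-++⁺ʳ (links TA) p)
    used′ : ∀ {t} → t ∈ (α , β , join TA TB) ∷ S → ∀ {l} → l ∈ linksOf t → ∀ {p} → OnLink p l → p ∈ (v , x) ∷ (v , y) ∷ used
    used′ (here refl) {l} l∈ on rewrite links-join TA TB with ∈-++⁻ (links TA) l∈
    ... | inj₁ l∈A         = there (there (links-used V (here refl) l∈A on))
    ... | inj₂ (there l∈B) = there (there (links-used V (there (here refl)) l∈B on))
    ... | inj₂ (here refl) with on
    ...   | inj₁ e = here e
    ...   | inj₂ e = there (here e)
    used′ (there t∈) l∈ on = there (there (links-used V (there (there t∈)) l∈ on))
    keeps : ∀ {l} → HasLink ((α , just (v , x) , TA) ∷ (just (v , y) , β , TB) ∷ S) l → HasLink ((α , β , join TA TB) ∷ S) l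
    keeps (here (inj₁ p))          = here (inj₁ (joined-link (inj₁ p)))
    keeps (here (inj₂ p))          = here (inj₂ (joined-link (inj₁ p)))
    keeps (there (here (inj₁ p)))  = here (inj₁ (joined-link (inj₂ (there p))))
    keeps (there (here (inj₂ p)))  = here (inj₂ (joined-link (inj₂ (there p))))
    keeps (there (there h))        = there h
    boundVia : BoundAfterJoin ((α , just (v , x) , TA) ∷ (just (v , y) , β , TB) ∷ S) ((α , β , join TA TB) ∷ S) (v , x) (v , y)
    boundVia (here (inj₁ (e₁ , e₂))) = inj₂ (inj₁ (here (inj₁ (e₁ , refl)) , there (here (inj₁ (refl , e₂)))))
    boundVia (here (inj₂ (e₁ , e₂))) = inj₂ (inj₂ (there (here (inj₂ (refl , e₂))) , here (inj₂ (e₁ , refl))))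
    boundVia (there a)               = inj₁ (there (there a))

  -- Joining two distinct unused ends x, y at v that do not bound a common
  -- piece: find the piece ending at x (orient it to end there), then the
  -- piece ending at y (orient it to start there), and join them.  Only the
  -- interface of merge matters later, so it is kept opaque.
  opaque
    merge : ∀ {S used} → Valid S used → ∀ {v} (x y : Fin (deg v)) → (v , x) ∉ used → (v , y) ∉ used → x ≢ y →
            ¬ Bound S (v , x) (v , y) → Joined S used v x y
    merge {S} {used} V {v} x y x∉ y∉ x≢y unbound with pick (unused-is-end V x∉)
    ... | (fr , bk , T) , x-end , S₁ , S↭ = joined-rearranged (permute S↭) (orient-first x-end)
      where
      V₁ : Valid ((fr , bk , T) ∷ S₁) used
      V₁ = valid (permute S↭) V
      with-second : ∀ {α} (TA : Segment α (just (v , x))) → Valid ((α , just (v , x) , TA) ∷ S₁) used →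
                    ¬ Bound ((α , just (v , x) , TA) ∷ S₁) (v , x) (v , y) →
                    Joined ((α , just (v , x) , TA) ∷ S₁) used v x y
      with-second {α} TA V₂ unbound₂ with unused-is-end V₂ y∉
      ... | here (inj₁ e) = ⊥-elim (unbound₂ (here (inj₂ (e , refl))))
      ... | here (inj₂ e) = ⊥-elim (x≢y (position-injective (Maybeₚ.just-injective e)))
      ... | there y-end with pick y-end
      ... | (frB , bkB , TB) , y-endB , S₂ , S₁↭ = joined-rearranged E₂ (orient-second y-endB)
        where
        E₂ : Rearrangement ((α , just (v , x) , TA) ∷ S₁) ((α , just (v , x) , TA) ∷ (frB , bkB , TB) ∷ S₂)
        E₂ = permute (prep (α , just (v , x) , TA) S₁↭)
        V₃ : Valid ((α , just (v , x) , TA) ∷ (frB , bkB , TB) ∷ S₂) used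
        V₃ = valid E₂ V₂
        orient-second : frB ≡ just (v , y) ⊎ bkB ≡ just (v , y) →
                        Joined ((α , just (v , x) , TA) ∷ (frB , bkB , TB) ∷ S₂) used v x y
        orient-second (inj₁ refl) = join-first-two TA TB S₂ V₃
        orient-second (inj₂ refl) = joined-rearranged E₃ (join-first-two TA (reverse TB) S₂ (valid E₃ V₃))
          where
          E₃ : Rearrangement ((α , just (v , x) , TA) ∷ (frB , just (v , y) , TB) ∷ S₂)
                             ((α , just (v , x) , TA) ∷ (just (v , y) , frB , reverse TB) ∷ S₂)
          E₃ = rearrangement-trans (permute (swap _ _ ↭-refl))
                 (rearrangement-trans (reverse-first TB ((α , just (v , x) , TA) ∷ S₂)) (permute (swap _ _ ↭-refl)))
      orient-first : fr ≡ just (v , x) ⊎ bk ≡ just (v , x) → Joined ((fr , bk , T) ∷ S₁) used v x y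
      orient-first (inj₂ refl) = with-second T V₁ (unbound ∘ bound (permute S↭))
      orient-first (inj₁ refl) = joined-rearranged E (with-second (reverse T) (valid E V₁) (unbound ∘ bound (permute S↭) ∘ bound E))
        where
        E : Rearrangement ((just (v , x) , bk , T) ∷ S₁) ((bk , just (v , x) , reverse T) ∷ S₁)
        E = reverse-first T S₁

module AtVertex (M : AbstractMap) where
  open AbstractMap M
  open Segments M
  open Systems M

  BoundAt : List Piece → (v : Fin n) → Fin (deg v) → Fin (deg v) → Set
  BoundAt S v x y = Bound S (v , x) (v , y)

  record ThreeJoined (S : List Piece) (used : List Position) (v : Fin n) (x₁ y₁ x₂ y₂ x₃ y₃ : Fin (deg v)) : Set where
    field
      S′      : List Piece
      used′   : List Position
      valid′  : Valid S′ used′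
      used-at : ∀ {p} → p ∈ used′ → proj₁ p ≡ v ⊎ p ∈ used
      link₁   : HasLink S′ (v , x₁ , y₁)
      link₂   : HasLink S′ (v , x₂ , y₂)
      link₃   : HasLink S′ (v , x₃ , y₃)
      keeps   : ∀ {l} → HasLink S l → HasLink S′ l

  -- The first join is harmless because x₁ bounds no piece with an
  -- end at v, so afterwards the pairs of ends at v are pairs of S; the Safe
  -- hypothesis then rules out closing a piece in the second and third join.
  three-joins : ∀ {S used} → Valid S used → ∀ {v} → (∀ x → (v , x) ∉ used) → (x₁ y₁ x₂ y₂ x₃ y₃ : Fin (deg v)) →
                Distinct (x₁ ∷ y₁ ∷ x₂ ∷ y₂ ∷ x₃ ∷ y₃ ∷ []) → (∀ y → ¬ BoundAt S v x₁ y) →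
                Safe (BoundAt S v) x₂ y₂ x₃ y₃ → ThreeJoined S used v x₁ y₁ x₂ y₂ x₃ y₃
  three-joins {S} {used} V {v} free x₁ y₁ x₂ y₂ x₃ y₃ (x₁∉ , y₁∉ , x₂∉ , y₂∉ , x₃∉ , _) x₁-unbound (s₁ , s₂ , s₃ , s₄) =
    record
      { S′ = Joined.S′ J₃ ; used′ = _ ; valid′ = Joined.valid′ J₃ ; used-at = used-at
      ; link₁ = Joined.keeps J₃ (Joined.keeps J₂ (Joined.newLink J₁))
      ; link₂ = Joined.keeps J₃ (Joined.newLink J₂)
      ; link₃ = Joined.newLink J₃
      ; keeps = Joined.keeps J₃ ∘ Joined.keeps J₂ ∘ Joined.keeps J₁ }
    where
    apart : ∀ {a c : Fin (deg v)} {xs} → a ∉ xs → c ∈ xs → c ≢ a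
    apart a∉ c∈ refl = a∉ c∈
    still-free : ∀ {x a c} {U : List Position} → (v , x) ∉ U → x ≢ a → x ≢ c → (v , x) ∉ (v , a) ∷ (v , c) ∷ U
    still-free f x≢a x≢c (here e)         = x≢a (position-injective e)
    still-free f x≢a x≢c (there (here e)) = x≢c (position-injective e)
    still-free f x≢a x≢c (there (there p)) = f p

    J₁ = merge V x₁ y₁ (free x₁) (free y₁) (apart x₁∉ (here refl) ∘ sym) (x₁-unbound y₁)
    bound₁ : ∀ {a c} → BoundAt (Joined.S′ J₁) v a c → BoundAt S v a c
    bound₁ b with Joined.boundVia J₁ b
    ... | inj₁ p                = p
    ... | inj₂ (inj₁ (p , _))  = ⊥-elim (x₁-unbound _ (bound-sym p))
    ... | inj₂ (inj₂ (_ , p))  = ⊥-elim (x₁-unbound _ p)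

    J₂ = merge (Joined.valid′ J₁) x₂ y₂
           (still-free (free x₂) (apart x₁∉ (there (here refl))) (apart y₁∉ (here refl)))
           (still-free (free y₂) (apart x₁∉ (there (there (here refl)))) (apart y₁∉ (there (here refl))))
           (apart x₂∉ (here refl) ∘ sym) (s₁ ∘ bound₁)
    bound₂ : ∀ {a c} → BoundAt (Joined.S′ J₂) v a c →
             BoundAt S v a c ⊎ (BoundAt S v a x₂ × BoundAt S v y₂ c) ⊎ (BoundAt S v a y₂ × BoundAt S v x₂ c)
    bound₂ b with Joined.boundVia J₂ b
    ... | inj₁ p                = inj₁ (bound₁ p)
    ... | inj₂ (inj₁ (p , q))  = inj₂ (inj₁ (bound₁ p , bound₁ q))
    ... | inj₂ (inj₂ (p , q))  = inj₂ (inj₂ (bound₁ p , bound₁ q))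
    unsafe₃ : ¬ BoundAt (Joined.S′ J₂) v x₃ y₃
    unsafe₃ b with bound₂ b
    ... | inj₁ p          = s₂ p
    ... | inj₂ (inj₁ pq) = s₃ pq
    ... | inj₂ (inj₂ pq) = s₄ pq

    J₃ = merge (Joined.valid′ J₂) x₃ y₃
           (still-free (still-free (free x₃) (apart x₁∉ (there (there (there (here refl)))))
                                             (apart y₁∉ (there (there (here refl)))))
                       (apart x₂∉ (there (here refl))) (apart y₂∉ (here refl)))
           (still-free (still-free (free y₃) (apart x₁∉ (there (there (there (there (here refl))))))
                                             (apart y₁∉ (there (there (there (here refl))))))
                       (apart x₂∉ (there (there (here refl)))) (apart y₂∉ (there (here refl))))
           (apart x₃∉ (here refl) ∘ sym) unsafe₃

    used-at : ∀ {p} → p ∈ (v , x₃) ∷ (v , y₃) ∷ (v , x₂) ∷ (v , y₂) ∷ (v , x₁) ∷ (v , y₁) ∷ used → proj₁ p ≡ v ⊎ p ∈ used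
    used-at (here refl)                                                 = inj₁ refl
    used-at (there (here refl))                                         = inj₁ refl
    used-at (there (there (here refl)))                                 = inj₁ refl
    used-at (there (there (there (here refl))))                         = inj₁ refl
    used-at (there (there (there (there (here refl)))))                 = inj₁ refl
    used-at (there (there (there (there (there (here refl))))))         = inj₁ refl
    used-at (there (there (there (there (there (there p))))))           = inj₂ p

-- Treating one odd vertex

module OddVertex (M : AbstractMap) where
  open AbstractMap M
  open Segments M
  open Systems M
  open AtVertex M
  open Valid

  LinkedAt : List Piece → (v : Fin n) → ℕ → ℕ → Set
  LinkedAt S v a c = ∃[ x ] ∃[ y ] (Rep M v a x × Rep M v c y × HasLink S (v , x , y))

  CompatibleAt : List Piece → Fin n → Set
  CompatibleAt S v = ∃[ i ] (LinkedAt S v i (i + 5) × LinkedAt S v (i + 1) (i + 3) × LinkedAt S v (i + 2) (i + 4))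

  compatible-kept : ∀ {S S′} → (∀ {l} → HasLink S l → HasLink S′ l) → ∀ {v} → CompatibleAt S v → CompatibleAt S′ v
  compatible-kept keeps (i , (x₁ , y₁ , r₁ , r₁′ , h₁) , (x₂ , y₂ , r₂ , r₂′ , h₂) , (x₃ , y₃ , r₃ , r₃′ , h₃)) =
    i , (x₁ , y₁ , r₁ , r₁′ , keeps h₁) , (x₂ , y₂ , r₂ , r₂′ , keeps h₂) , (x₃ , y₃ , r₃ , r₃′ , keeps h₃)

  linked : ∀ {S v a c} {x y : Fin (deg v)} → Rep M v a x → Rep M v c y → HasLink S (v , x , y) → LinkedAt S v a c
  linked rx ry h = _ , _ , rx , ry , h

  linked-swapped : ∀ {S v a c} {x y : Fin (deg v)} → Rep M v a x → Rep M v c y → HasLink S (v , y , x) → LinkedAt S v a c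
  linked-swapped rx ry h = _ , _ , rx , ry , Any.map Sum.swap h

  odd-degree : ∀ d → d ≢ 1 × d ≢ 3 × d ≢ 5 → Odd M d → d ≡ 7 ⊎ 9 ≤ d
  odd-degree d (≢1 , ≢3 , ≢5) (0 , d≡1) = ⊥-elim (≢1 d≡1)
  odd-degree d (≢1 , ≢3 , ≢5) (1 , d≡3) = ⊥-elim (≢3 d≡3)
  odd-degree d (≢1 , ≢3 , ≢5) (2 , d≡5) = ⊥-elim (≢5 d≡5)
  odd-degree d _ (3 , refl) = inj₁ refl
  odd-degree d _ (suc (suc (suc (suc h))) , refl) = inj₂ (s≤s (+-mono-≤ (m≤m+n 4 h) (m≤m+n 4 h)))

  record Treated (S : List Piece) (used : List Position) (v : Fin n) : Set where
    field
      S′         : List Piece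
      used′      : List Position
      valid′     : Valid S′ used′
      used-at    : ∀ {p} → p ∈ used′ → proj₁ p ≡ v ⊎ p ∈ used
      compatible : CompatibleAt S′ v
      keeps      : ∀ {l} → HasLink S l → HasLink S′ l

  module Treat {S : List Piece} {used : List Position} (V : Valid S used) (v : Fin n)
               (free : ∀ x → (v , x) ∉ used) (odd : Odd M (deg v)) (large : deg v ≡ 7 ⊎ 9 ≤ deg v) where

    7≤d : 7 ≤ deg v
    7≤d = Sum.[ ≤-reflexive ∘ sym , ≤-trans (n≤1+n 7) ∘ ≤-trans (n≤1+n 8) ] large

    6≤d : 6 ≤ deg v
    6≤d = ≤-trans (n≤1+n 6) 7≤d

    instance
      deg-nonZero : NonZero (deg v)
      deg-nonZero = >-nonZero (≤-trans (s≤s z≤n) 7≤d)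

    R = BoundAt S v

    R-fun : ∀ {x y z} → R x y → R x z → y ≡ z
    R-fun p q = position-injective (bound-functional S (distinct V) p q)

    -- Since deg v is odd, some end u at v bounds no piece with another end at v.
    free-end : ∃[ u ] (∀ y → ¬ R u y)
    free-end = unmatched-point R (λ x y → bound? S (v , x) (v , y)) bound-sym R-fun
                 (bound-irreflexive S (distinct V)) odd

    u = proj₁ free-end

    -- Number the ends around v so that u sits at position 5.
    B : ℕ
    B = toℕ u + deg v ∸ 5

    -- z c is the end at position c; only the following properties of z are
    -- used, so it is kept opaque.
    opaque
      z : ℕ → Fin (deg v)
      z c = (B + c) mod deg v

      z5≡u : z 5 ≡ u
      z5≡u = begin
        (toℕ u + deg v ∸ 5 + 5) mod deg v ≡⟨ cong (_mod deg v) (m∸n+n≡m 5≤u+d) ⟩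
        (toℕ u + deg v) mod deg v         ≡⟨ mod-periodic (toℕ u) (deg v) ⟩
        toℕ u mod deg v                   ≡⟨ mod-toℕ (deg v) u ⟩
        u                                 ∎
        where
        open ≡-Reasoning
        5≤u+d : 5 ≤ toℕ u + deg v
        5≤u+d = ≤-trans (≤-trans (n≤1+n 5) (n≤1+n 6)) (≤-trans 7≤d (m≤n+m (deg v) (toℕ u)))

      rep₀ : ∀ k → Rep M v (B + k) (z k)
      rep₀ k = (B + k) / deg v , mod-rep (B + k) (deg v)

      rep : ∀ k j → Rep M v (B + k + j) (z (k + j))
      rep k j = (B + (k + j)) / deg v , trans (+-assoc B k j) (mod-rep (B + (k + j)) (deg v))

      z-periodic : ∀ k → z (k + deg v) ≡ z k
      z-periodic k = trans (cong (_mod deg v) (sym (+-assoc B k (deg v)))) (mod-periodic (B + k) (deg v))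

      z-apart : ∀ a c → a < c → c < a + deg v → z a ≢ z c
      z-apart a c a<c c<a+d = mod-injective-window (B + a) (B + c) (deg v) (+-monoʳ-< B a<c)
                                (subst (B + c <_) (sym (+-assoc B a (deg v))) (+-monoʳ-< B c<a+d))

    z5-free : ∀ y → ¬ R (z 5) y
    z5-free = subst (λ w → ∀ y → ¬ R w y) (sym z5≡u) (proj₂ free-end)

    near : ℕ → ℕ → Bool
    near a c = ((a <ᵇ c) ∧ (c ≤ᵇ a + 5)) ∨ ((c <ᵇ a) ∧ (a ≤ᵇ c + 5))

    z-near : ∀ a c → T (near a c) → z a ≢ z c
    z-near a c t with Equivalence.to T-∨ t
    ... | inj₁ t′ = let (a<c , c≤a+5) = Equivalence.to T-∧ t′ in
                    z-apart a c (<ᵇ⇒< a c a<c) (≤-<-trans (≤ᵇ⇒≤ c (a + 5) c≤a+5) (+-monoʳ-< a 6≤d))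
    ... | inj₂ t′ = let (c<a , a≤c+5) = Equivalence.to T-∧ t′ in
                    z-apart c a (<ᵇ⇒< c a c<a) (≤-<-trans (≤ᵇ⇒≤ a (c + 5) a≤c+5) (+-monoʳ-< c 6≤d)) ∘ sym

    near-all : ℕ → List ℕ → Bool
    near-all k []        = true
    near-all k (k′ ∷ ks) = near k k′ ∧ near-all k ks

    pairwise-near : List ℕ → Bool
    pairwise-near []       = true
    pairwise-near (k ∷ ks) = near-all k ks ∧ pairwise-near ks

    z-distinct : ∀ ks → T (pairwise-near ks) → Distinct (map z ks)
    z-distinct []       _ = tt
    z-distinct (k ∷ ks) t = fresh ks (proj₁ split) , z-distinct ks (proj₂ split)
      where
      split = Equivalence.to T-∧ t
      fresh : ∀ ks → T (near-all k ks) → z k ∉ map z ks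
      fresh (k′ ∷ ks) t′ (here eq)  = z-near k k′ (proj₁ (Equivalence.to T-∧ t′)) eq
      fresh (k′ ∷ ks) t′ (there k∈) = fresh ks (proj₂ (Equivalence.to T-∧ t′)) k∈

    z-apart-in : ∀ k i j → k ≤ deg v → T (inRange k i j) → z i ≢ z j
    z-apart-in k i j k≤d t =
      let (1≤i , i<j , j≤k) = Product.map₂ (Equivalence.to (T-∧ {i <ᵇ j} {j ≤ᵇ k})) (Equivalence.to T-∧ t) in
      z-apart i j (<ᵇ⇒< i j i<j) (≤-trans (s≤s (≤-trans (≤ᵇ⇒≤ j k j≤k) k≤d)) (+-monoˡ-≤ (deg v) (≤ᵇ⇒≤ 1 i 1≤i)))

    open WindowLemma R (λ x y → bound? S (v , x) (v , y)) bound-sym R-fun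

    safe-window : SomeSafeWindow R z
    safe-window = by-degree large
      where
      by-degree : deg v ≡ 7 ⊎ 9 ≤ deg v → SomeSafeWindow R z
      by-degree (inj₂ 9≤d) = Nine.safe-window-nine z (λ i j → z-apart-in 9 i j 9≤d)
      by-degree (inj₁ d≡7) = Seven.safe-window-seven z (λ i j → z-apart-in 7 i j (≤-reflexive (sym d≡7)))
                               (wrap 1) (wrap 2)
        where
        wrap : ∀ k → z (k + 7) ≡ z k
        wrap k = trans (cong (λ d → z (k + d)) (sym d≡7)) (z-periodic k)

    treated : ∀ {x₁ y₁ x₂ y₂ x₃ y₃} (joins : ThreeJoined S used v x₁ y₁ x₂ y₂ x₃ y₃) →
              CompatibleAt (ThreeJoined.S′ joins) v → Treated S used v
    treated joins c = record { S′ = S′ ; used′ = used′ ; valid′ = valid′ ; used-at = used-at ; compatible = c ; keeps = keeps }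
      where open ThreeJoined joins

    result : Treated S used v
    result with safe-window
    -- window B + 5: pairs (5 , 10), (6 , 8), (7 , 9)
    ... | inj₁ s = treated joins
        (B + 5 , linked (rep₀ 5) (rep 5 5) link₁ , linked (rep 5 1) (rep 5 3) link₂ , linked (rep 5 2) (rep 5 4) link₃)
      where
      joins = three-joins V free (z 5) (z 10) (z 6) (z 8) (z 7) (z 9) (z-distinct (5 ∷ 10 ∷ 6 ∷ 8 ∷ 7 ∷ 9 ∷ []) tt) z5-free s
      open ThreeJoined joins
    -- window B + 0: pairs (0 , 5), (1 , 3), (2 , 4)
    ... | inj₂ (inj₁ s) = treated joins
        (B + 0 , linked-swapped (rep₀ 0) (rep 0 5) link₁ , linked (rep 0 1) (rep 0 3) link₂ , linked (rep 0 2) (rep 0 4) link₃)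
      where
      joins = three-joins V free (z 5) (z 0) (z 1) (z 3) (z 2) (z 4) (z-distinct (5 ∷ 0 ∷ 1 ∷ 3 ∷ 2 ∷ 4 ∷ []) tt) z5-free s
      open ThreeJoined joins
    -- window B + 4: pairs (4 , 9), (5 , 7), (6 , 8)
    ... | inj₂ (inj₂ (inj₁ s)) = treated joins
        (B + 4 , linked (rep₀ 4) (rep 4 5) link₂ , linked (rep 4 1) (rep 4 3) link₁ , linked (rep 4 2) (rep 4 4) link₃)
      where
      joins = three-joins V free (z 5) (z 7) (z 4) (z 9) (z 6) (z 8) (z-distinct (5 ∷ 7 ∷ 4 ∷ 9 ∷ 6 ∷ 8 ∷ []) tt) z5-free s
      open ThreeJoined joins
    -- window B + 3: pairs (3 , 8), (4 , 6), (5 , 7)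
    ... | inj₂ (inj₂ (inj₂ (inj₁ s))) = treated joins
        (B + 3 , linked (rep₀ 3) (rep 3 5) link₂ , linked (rep 3 1) (rep 3 3) link₃ , linked (rep 3 2) (rep 3 4) link₁)
      where
      joins = three-joins V free (z 5) (z 7) (z 3) (z 8) (z 4) (z 6) (z-distinct (5 ∷ 7 ∷ 3 ∷ 8 ∷ 4 ∷ 6 ∷ []) tt) z5-free s
      open ThreeJoined joins
    -- window B + 2: pairs (2 , 7), (3 , 5), (4 , 6)
    ... | inj₂ (inj₂ (inj₂ (inj₂ s))) = treated joins
        (B + 2 , linked (rep₀ 2) (rep 2 5) link₂ , linked-swapped (rep 2 1) (rep 2 3) link₁ , linked (rep 2 2) (rep 2 4) link₃)
      where
      joins = three-joins V free (z 5) (z 3) (z 2) (z 7) (z 4) (z 6) (z-distinct (5 ∷ 3 ∷ 2 ∷ 7 ∷ 4 ∷ 6 ∷ []) tt) z5-free s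
      open ThreeJoined joins

module Decomposition (M : AbstractMap) where
  open AbstractMap M
  open Segments M
  open Systems M
  open OddVertex M
  open Valid
  open OrientedEdge

  allPositions : List Position
  allPositions = concatMap (λ v → map (v ,_) (allFin (deg v))) (allFin n)

  ∈-allPositions : ∀ p → p ∈ allPositions
  ∈-allPositions (v , x) =
    ∈-concatMap⁺ (λ w → map (w ,_) (allFin (deg w))) {xs = allFin n} (Any.map (λ { refl → ∈-map⁺ (v ,_) (∈-allFin x) }) (∈-allFin v))

  initialEdge : Fin m → OrientedEdge
  initialEdge e with surjective e
  ... | p , ep with Any.any? (λ q → (edgeAt q Finₚ.≟ e) ×-dec ¬? (Productₚ.≡-dec Finₚ._≟_ Finₚ._≟_ q p)) allPositions
  ... | yes other = record { edge = e ; src = just p ; tgt = just q ; src-ok = λ { refl → ep } ; tgt-ok = λ { refl → eq }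
                           ; src≢tgt = λ e → q≢p (sym (Maybeₚ.just-injective e)) ; src-or-tgt = ends }
    where
    q = proj₁ (Any.satisfied other)
    eq = proj₁ (proj₂ (Any.satisfied other))
    q≢p = proj₂ (proj₂ (Any.satisfied other))
    ends : ∀ r → edgeAt r ≡ e → just p ≡ just r ⊎ just q ≡ just r
    ends r er with atMostTwo p q r (trans ep (sym eq)) (trans eq (sym er))
    ... | inj₁ p≡q         = ⊥-elim (q≢p (sym p≡q))
    ... | inj₂ (inj₁ q≡r) = inj₂ (cong just q≡r)
    ... | inj₂ (inj₂ p≡r) = inj₁ (cong just p≡r)
  ... | no none = record { edge = e ; src = just p ; tgt = nothing ; src-ok = λ { refl → ep } ; tgt-ok = λ ()
                         ; src≢tgt = λ () ; src-or-tgt = ends }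
    where
    ends : ∀ r → edgeAt r ≡ e → just p ≡ just r ⊎ nothing ≡ just r
    ends r er with Productₚ.≡-dec Finₚ._≟_ Finₚ._≟_ r p
    ... | yes r≡p = inj₁ (cong just (sym r≡p))
    ... | no r≢p  = ⊥-elim (none (Any.map (λ { refl → er , r≢p }) (∈-allPositions r)))

  initialEdge-edge : ∀ e → edge (initialEdge e) ≡ e
  initialEdge-edge e with surjective e
  ... | p , ep with Any.any? (λ q → (edgeAt q Finₚ.≟ e) ×-dec ¬? (Productₚ.≡-dec Finₚ._≟_ Finₚ._≟_ q p)) allPositions
  ... | yes _ = refl
  ... | no _  = refl

  initialPiece : Fin m → Piece
  initialPiece e = src (initialEdge e) , tgt (initialEdge e) , single (initialEdge e) refl refl

  S₀ : List Piece
  S₀ = map initialPiece (allFin m)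

  allEdges-S₀ : allEdges S₀ ≡ allFin m
  allEdges-S₀ = go (allFin m)
    where
    go : ∀ es → allEdges (map initialPiece es) ≡ es
    go []       = refl
    go (e ∷ es) = cong₂ _∷_ (initialEdge-edge e) (go es)

  valid₀ : Valid S₀ []
  valid₀ = record
    { distinct   = subst Distinct (sym allEdges-S₀) (Unique⇒Distinct (allFin⁺ m))
    ; covers     = λ e → subst (e ∈_) (sym allEdges-S₀) (∈-allFin e)
    ; links-used = no-links }
    where
    no-links : ∀ {t} → t ∈ S₀ → ∀ {l} → l ∈ linksOf t → ∀ {p} → OnLink p l → p ∈ []
    no-links t∈ l∈ on with ∈-map⁻ initialPiece t∈
    no-links t∈ () on | _ , _ , refl

  record Progress (vs : List (Fin n)) : Set where
    field
      S          : List Piece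
      used       : List Position
      valid      : Valid S used
      used-in    : ∀ {p} → p ∈ used → proj₁ p ∈ vs
      compatible : ∀ {v} → v ∈ vs → Odd M (deg v) → CompatibleAt S v
  open Progress

  -- Treat one more vertex v; its ends are all still free.
  step : (∀ v → deg v ≢ 1 × deg v ≢ 3 × deg v ≢ 5) → ∀ {vs} → Progress vs → ∀ v → v ∉ vs → Progress (v ∷ vs)
  step hyp P v v∉ with parity (deg v)
  ... | inj₂ (h , even) = record
    { S = S P ; used = used P ; valid = valid P ; used-in = there ∘ used-in P
    ; compatible = λ { (here refl) (h′ , odd) → ⊥-elim (even≢odd′ h h′ (trans (sym even) odd))
                     ; (there w∈) → compatible P w∈ } }
  ... | inj₁ odd = record
    { S = Treated.S′ done ; used = Treated.used′ done ; valid = Treated.valid′ done ; used-in = used-in′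
    ; compatible = λ { (here refl) _ → Treated.compatible done
                     ; (there w∈) o → compatible-kept (Treated.keeps done) (compatible P w∈ o) } }
    where
    done : Treated (S P) (used P) v
    done = Treat.result (valid P) v (λ x p∈ → v∉ (used-in P p∈)) odd (odd-degree (deg v) (hyp v) odd)
    used-in′ : ∀ {p} → p ∈ Treated.used′ done → proj₁ p ∈ v ∷ _
    used-in′ p∈ with Treated.used-at done p∈
    ... | inj₁ e = here e
    ... | inj₂ q = there (used-in P q)

  treat-all : (∀ v → deg v ≢ 1 × deg v ≢ 3 × deg v ≢ 5) → ∀ vs → Distinct vs → Progress vs
  treat-all hyp []       _          = record { S = S₀ ; used = [] ; valid = valid₀ ; used-in = λ () ; compatible = λ () }
  treat-all hyp (v ∷ vs) (v∉ , u) = step hyp (treat-all hyp vs u) v v∉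

  module Trails (S : List Piece) (u : Distinct (allEdges S)) where
    open AsTrail

    distinct-at : ∀ S → Distinct (allEdges S) → (j : Fin (length S)) → Distinct (edgesOf (lookup S j))
    distinct-at (t ∷ S) u fzero    = distinct-++ˡ (edgesOf t) (allEdges S) u
    distinct-at (t ∷ S) u (fsuc j) = distinct-at S (distinct-++ʳ (edgesOf t) (allEdges S) u) j

    segment : (j : Fin (length S)) → Segment (proj₁ (lookup S j)) (proj₁ (proj₂ (lookup S j)))
    segment j = proj₂ (proj₂ (lookup S j))

    trail : Fin (length S) → Trail M
    trail j = toTrail (segment j) (distinct-at S u j)

    some-index : ∀ {P : Piece → Set} {S} → Any P S → ∃[ j ] P (lookup S j)
    some-index (here p)  = fzero , p
    some-index (there a) = Product.map fsuc (λ p → p) (some-index a)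

    edge-piece : ∀ S {e} → e ∈ allEdges S → ∃[ j ] (e ∈ edgesOf (lookup S j))
    edge-piece S e∈ with ∈-allEdges⁻ S e∈
    ... | t , t∈ , e∈t = some-index (Any.map (λ { refl → e∈t }) t∈)

    piece-unique : ∀ S → Distinct (allEdges S) → ∀ j j′ {e} → e ∈ edgesOf (lookup S j) → e ∈ edgesOf (lookup S j′) → j ≡ j′
    piece-unique (t ∷ S) u fzero    fzero     p q = refl
    piece-unique (t ∷ S) u fzero    (fsuc j′) p q = ⊥-elim (distinct-++-disjoint (edgesOf t) (allEdges S) u p (∈-allEdges⁺ S (∈-lookup j′) q))
    piece-unique (t ∷ S) u (fsuc j) fzero     p q = ⊥-elim (distinct-++-disjoint (edgesOf t) (allEdges S) u q (∈-allEdges⁺ S (∈-lookup j) p))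
    piece-unique (t ∷ S) u (fsuc j) (fsuc j′) p q = cong fsuc (piece-unique S (distinct-++ʳ (edgesOf t) (allEdges S) u) j j′ p q)

    consecutive : ∀ {v a c} → LinkedAt S v a c → ∃[ j ] ConsecutiveIn M (trail j) v a c
    consecutive (x , y , rx , ry , h) with some-index h
    ... | j , inj₁ l∈ = j , link-consecutive (segment j) (distinct-at S u j) l∈ rx ry
    ... | j , inj₂ l∈ = j , flip {trail j} (link-consecutive (segment j) (distinct-at S u j) l∈ ry rx)
      where
      flip : ∀ {W v a c} → ConsecutiveIn M W v c a → ConsecutiveIn M W v a c
      flip (t , e , p) = t , e , Sum.swap p

    decomposition : (∀ e → e ∈ allEdges S) → (∀ v → Odd M (deg v) → CompatibleAt S v) → CompatibleDecomposition M
    decomposition covers compat = record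
      { K          = length S
      ; W          = trail
      ; cover      = covered
      ; disjoint   = λ j j′ t t′ eq → piece-unique S u j j′ (edgeOf-∈ _ t) (subst (_∈ _) (sym eq) (edgeOf-∈ _ t′))
      ; compatible = λ v odd → let (i , l₁ , l₂ , l₃) = compat v odd in i , consecutive l₁ , consecutive l₂ , consecutive l₃ }
      where
      covered : ∀ e → ∃[ j ] ∃[ t ] Trail.edge (trail j) t ≡ e
      covered e with edge-piece S (covers e)
      ... | j , e∈ = j , ∈-edgeOf (segment j) e∈

lemma4 : (M : AbstractMap) →
    ((v : Fin (AbstractMap.n M)) →
    AbstractMap.deg M v ≢ 1 × AbstractMap.deg M v ≢ 3 × AbstractMap.deg M v ≢ 5) →
    CompatibleDecomposition M
lemma4 M hyp = Trails.decomposition S (Valid.distinct valid) (Valid.covers valid) (λ v → compatible (∈-allFin v))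
  where
  open Systems M using (module Valid)
  open Decomposition M
  open Progress (treat-all hyp (allFin _) (Unique⇒Distinct (allFin⁺ _)))
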